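{- Let $X$ be a finite simple graph with $m$ edges that is $2$-edge connected and bipartite, and let $s$ and $t$ be the sizes of the two parts of its bipartition. If $m > st/2$ or $2^{m-1} > |\mathrm{aut}\,K_{s,t}|$, then $X$ is edge reconstructible.
   Context: All graphs are finite, undirected, without loops or multiple edges. $\mathrm{aut}\,H$ denotes the automorphism group of a graph $H$, and $K_{s,t}$ is the complete bipartite graph with parts of sizes $s$ and $t$. The edge deck $ED(X)$ of a graph $X$ is the multiset of unlabelled graphs $X-e$, $e\in E(X)$. A graph $X$ is edge reconstructible if every graph $Y$ with $ED(Y)=ED(X)$ is isomorphic to $X$ (equivalently: whenever there is a bijection $f:E(X)\to E(Y)$ with $X-e\cong Y-f(e)$ for all $e\in E(X)$, then $X\cong Y$). -}

module Defs where

open import Data.Nat using (ℕ; zero; suc; _+_; _*_; _^_; _>_)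
import Data.Nat as ℕ
open import Data.Bool using (Bool; true; false; not; _∧_; _∨_; _xor_)
open import Data.Bool.Properties using (∧-comm; ∨-comm; xor-same)
open import Data.Fin using (Fin; toℕ; _<_)
open import Data.Fin.Properties using (all?; _≟_)
open import Data.Vec using (Vec; []; _∷_; lookup)
open import Data.List using (List; []; _∷_; [_]; length; filter; map; concatMap; allFin)
open import Data.Product using (Σ; _×_; _,_)
open import Function.Bundles using (_⤖_; Bijection)
open import Relation.Nullary using (Dec; yes; no; ¬_; _→-dec_)
open import Relation.Nullary.Decidable using (⌊_⌋; _×-dec_)
open import Relation.Binary.PropositionalEquality using (_≡_; refl; cong₂; trans; sym)
import Data.Bool as B

record Graph : Set where
  field
    n     : ℕ
    adj   : Fin n → Fin n → Bool
    adj-sym : ∀ i j → adj i j ≡ adj j i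
    adj-irr : ∀ i → adj i i ≡ false
open Graph public

-- Edges of X: unordered pairs {i,j}, represented canonically as i < j.
Edge : Graph → Set
Edge X = Σ (Fin (n X) × Fin (n X)) λ { (i , j) → (i < j) × (adj X i j ≡ true) }

_≅_ : Graph → Graph → Set
G ≅ H = Σ (Fin (n G) ⤖ Fin (n H)) λ φ →
          ∀ i j → adj G i j ≡ adj H (Bijection.to φ i) (Bijection.to φ j)

private
  isEnd : ∀ {k} → Fin k → Fin k → Fin k → Fin k → Bool
  isEnd a b i j = (⌊ i ≟ a ⌋ ∧ ⌊ j ≟ b ⌋) ∨ (⌊ i ≟ b ⌋ ∧ ⌊ j ≟ a ⌋)

  isEnd-sym : ∀ {k} (a b i j : Fin k) → isEnd a b i j ≡ isEnd a b j i
  isEnd-sym a b i j =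
    trans (∨-comm (⌊ i ≟ a ⌋ ∧ ⌊ j ≟ b ⌋) (⌊ i ≟ b ⌋ ∧ ⌊ j ≟ a ⌋))
          (cong₂ _∨_ (∧-comm ⌊ i ≟ b ⌋ ⌊ j ≟ a ⌋) (∧-comm ⌊ i ≟ a ⌋ ⌊ j ≟ b ⌋))

_─_ : (X : Graph) → Edge X → Graph
X ─ ((a , b) , _) = record
  { n = n X
  ; adj = λ i j → adj X i j ∧ not (isEnd a b i j)
  ; adj-sym = λ i j → cong₂ (λ u v → u ∧ not v) (adj-sym X i j) (isEnd-sym a b i j)
  ; adj-irr = λ i → cong₂ (λ u v → u ∧ not v) (adj-irr X i) (refl {x = isEnd a b i i})
  }

-- Edge reconstructibility: any Y with the same edge deck (witnessed by a
-- bijection of edge sets matching the cards) is isomorphic to X.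
EdgeReconstructible : Graph → Set
EdgeReconstructible X =
  (Y : Graph) (f : Edge X ⤖ Edge Y) →
  (∀ e → (X ─ e) ≅ (Y ─ Bijection.to f e)) →
  X ≅ Y

data Reach (G : Graph) : Fin (n G) → Fin (n G) → Set where
  here : ∀ {i} → Reach G i i
  step : ∀ {i k j} → adj G i k ≡ true → Reach G k j → Reach G i j

Connected : Graph → Set
Connected G = ∀ i j → Reach G i j

TwoEdgeConnected : Graph → Set
TwoEdgeConnected G = Connected G × (∀ e → Connected (G ─ e))

IsBipartition : (X : Graph) → (Fin (n X) → Bool) → Set
IsBipartition X c = ∀ i j → adj X i j ≡ true → ¬ (c i ≡ c j)

partSize : ∀ {k} → (Fin k → Bool) → Bool → ℕ
partSize {k} c b = length (filter (λ i → c i B.≟ b) (allFin k))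

-- The complete bipartite graph K_{s,t} on Fin (s + t): the first s vertices
-- form one part, the remaining t vertices the other.
K : ℕ → ℕ → Graph
K s t = record
  { n = s + t
  ; adj = λ i j → inA i xor inA j
  ; adj-sym = λ i j → xor-comm (inA i) (inA j)
  ; adj-irr = λ i → xor-same (inA i)
  }
  where
  inA : Fin (s + t) → Bool
  inA i = ⌊ toℕ i ℕ.<? s ⌋
  xor-comm : ∀ x y → x xor y ≡ y xor x
  xor-comm false false = refl
  xor-comm false true = refl
  xor-comm true false = refl
  xor-comm true true = refl

allVecs : (k l : ℕ) → List (Vec (Fin k) l)
allVecs k zero = [ [] ]
allVecs k (suc l) = concatMap (λ i → map (i ∷_) (allVecs k l)) (allFin k)

-- A vertex map (as a lookup table) is an automorphism of H:
-- injective (hence bijective, the vertex set being finite) and adjacency-preserving.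
IsAut : (H : Graph) → Vec (Fin (n H)) (n H) → Set
IsAut H v = (∀ i j → lookup v i ≡ lookup v j → i ≡ j)
          × (∀ i j → adj H i j ≡ adj H (lookup v i) (lookup v j))

isAut? : (H : Graph) → (v : Vec (Fin (n H)) (n H)) → Dec (IsAut H v)
isAut? H v =
  all? (λ i → all? (λ j → (lookup v i ≟ lookup v j) →-dec (i ≟ j)))
  ×-dec
  all? (λ i → all? (λ j → adj H i j B.≟ adj H (lookup v i) (lookup v j)))

autOrder : Graph → ℕ
autOrder H = length (filter (isAut? H) (allVecs (n H) (n H)))

{-# OPTIONS --safe #-}
-- Following Lovász and Müller, identify the colour classes of X with the sides of K s t and count
-- automorphisms σ of K s t. For a set F of edges of X let A_Y F (resp. A_X F) be the number of σ
-- mapping exactly the edges in F onto edges of Y (resp. of X). Once Y is known to be bipartite with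
-- the same classes, and the card isomorphisms to respect them (this is where 2-edge-connectivity
-- enters), Kelly's lemma shows that the sums of A_Y and of A_X over all supersets of F agree for
-- every proper subset F of E(X). Möbius inversion then gives A_Y F − A_X F = ±(A_Y E − A_X E).
-- If 2m > st, no σ maps X into the complement of X or of Y, so A_Y ∅ = A_X ∅ = 0 and therefore
-- A_Y E = A_X E ≥ 1. If instead A_Y E = 0, then A_X F ≥ A_X E ≥ 1 for the 2^(m−1) sets F with
-- complement of even size, so 2 |aut K s t| ≥ 2^m. In both cases some σ maps X onto Y.
module Submission where

open import Defs
open import Data.Nat using (ℕ; _*_; _^_; _>_)
open import Data.Bool using (Bool; true; false)
open import Data.Fin using (Fin)
open import Data.Sum using (_⊎_)
open import Function.Bundles using (_⤖_)

open import Data.Nat hiding (_≟_)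
open import Data.Nat.Properties hiding (_≟_; <-irrelevant; <-cmp; <-asym)
open import Data.Nat.Solver using () renaming (module +-*-Solver to ℕ-Solver)
open import Data.Integer as ℤ using (ℤ; -_; 0ℤ; 1ℤ; -1ℤ) renaming (+_ to pos)
import Data.Integer.Properties as ℤ
open import Data.Integer.Solver using () renaming (module +-*-Solver to ℤ-Solver)
open import Data.Bool using (not; _∧_; _∨_; _xor_; if_then_else_)
import Data.Bool as Bool
open import Data.Bool.Properties
  using (∧-comm; ∨-comm; ∧-zeroʳ; ∨-zeroʳ; not-involutive; xor-same; xor-assoc; xor-comm; xor-annihilates-not)
open import Data.Fin using (zero; suc; toℕ; punchOut; join; _↑ˡ_; _↑ʳ_) renaming (_<_ to _<ᶠ_)
open import Data.Fin.Properties using (_≟_; any?; punchOut-injective; injective⇒≤; +↔⊎; toℕ-↑ˡ; toℕ-↑ʳ; toℕ<n)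
  renaming (<-irrelevant to <ᶠ-irrelevant; <-cmp to <ᶠ-cmp; <-asym to <ᶠ-asym)
open import Data.Fin.Subset using (Subset; ⊤) renaming (⊥ to ∅)
open import Data.Fin.Permutation
  using (Permutation; Permutation′; permutation; flip; _⟨$⟩ʳ_; _⟨$⟩ˡ_; inverseˡ; inverseʳ)
open import Data.Vec using (Vec; []; _∷_; lookup; tabulate; replicate)
import Data.Vec as Vec
open import Data.Vec.Properties
  using (∷-injectiveʳ; ≡-dec; lookup∘tabulate; tabulate∘lookup; tabulate-cong; lookup-replicate)
import Data.Vec.Properties as Vec
open import Data.List using (List; []; _∷_; _++_; length; filter; map; concatMap)
import Data.List as List
open import Data.List.Properties using (filter-++; length-++)
open import Data.List.Membership.Propositional using (_∈_)
open import Data.List.Membership.Propositional.Properties using (∈-lookup)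
open import Data.List.Relation.Unary.Any using (here; there)
import Data.List.Relation.Unary.All as All
open import Data.List.Relation.Unary.All.Properties using (¬Any⇒All¬)
open import Data.List.Relation.Unary.AllPairs using ([]; _∷_)
open import Data.List.Relation.Unary.Unique.Propositional using (Unique)
open import Data.Product using (Σ; ∃; _×_; _,_; proj₁; proj₂)
open import Data.Sum using (inj₁; inj₂; [_,_]′)
import Data.Sum as Sum
open import Data.Sum.Properties using (swap-↔)
open import Data.Empty using (⊥; ⊥-elim)
open import Relation.Nullary using (Dec; does; yes; no; ¬_; contradiction)
open import Relation.Nullary.Decidable using (does-⇔; ⌊_⌋)
open import Relation.Unary using (Decidable)
open import Relation.Binary.Definitions using (tri<; tri≈; tri>)
open import Relation.Binary.PropositionalEquality
open import Relation.Binary.Construct.Closure.ReflexiveTransitive using (Star; ε; _◅_; gmap)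
open import Function using (_∘_; id; _↔_; Inverse; Bijection; mk↔ₛ′)
open import Function.Bundles using (mk⇔)
open import Function.Definitions using (Injective)
open import Function.Construct.Composition using (_↔-∘_; _⤖-∘_)
open import Function.Construct.Symmetry using (↔-sym)
open import Function.Properties.Bijection using (⤖⇒↔)
open import Function.Properties.Inverse using (↔⇒⤖)
open import Axiom.UniquenessOfIdentityProofs using (module Decidable⇒UIP)
open import Algebra.Properties.Semiring.Sum +-*-semiring
  using (sum; sum-syntax; sum-cong-≗; ∑-distrib-+; ∑-comm; sum-permute; *-distribˡ-sum; *-distribʳ-sum)
open import Algebra.Properties.CommutativeSemigroup +-commutativeSemigroup
  using () renaming (interchange to +-interchange)
import Algebra.Properties.CommutativeSemigroup *-commutativeSemigroup as ℕ*

-- Indicators and finite sums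

⟦_⟧ : Bool → ℕ
⟦ true ⟧ = 1
⟦ false ⟧ = 0

⟦⟧≤1 : ∀ b → ⟦ b ⟧ ≤ 1
⟦⟧≤1 true = ≤-refl
⟦⟧≤1 false = z≤n

⟦⟧-injective : ∀ {x y} → ⟦ x ⟧ ≡ ⟦ y ⟧ → x ≡ y
⟦⟧-injective {true} {true} _ = refl
⟦⟧-injective {false} {false} _ = refl

⟦⟧-pos : ∀ {b} → 0 < ⟦ b ⟧ → b ≡ true
⟦⟧-pos {true} _ = refl

⟦∧⟧ : ∀ x y → ⟦ x ∧ y ⟧ ≡ ⟦ x ⟧ * ⟦ y ⟧
⟦∧⟧ true y = sym (+-identityʳ _)
⟦∧⟧ false y = refl

⟦∨⟧≤ : ∀ x y → ⟦ x ∨ y ⟧ ≤ ⟦ x ⟧ + ⟦ y ⟧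
⟦∨⟧≤ true y = s≤s z≤n
⟦∨⟧≤ false y = ≤-refl

⟦not⟧+⟦⟧ : ∀ b → ⟦ not b ⟧ + ⟦ b ⟧ ≡ 1
⟦not⟧+⟦⟧ true = refl
⟦not⟧+⟦⟧ false = refl

⟦does⟧≡1 : ∀ {P : Set} (P? : Dec P) → P → ⟦ does P? ⟧ ≡ 1
⟦does⟧≡1 (yes _) _ = refl
⟦does⟧≡1 (no ¬p) p = contradiction p ¬p

⟦does⟧≡0 : ∀ {P : Set} (P? : Dec P) → ¬ P → ⟦ does P? ⟧ ≡ 0
⟦does⟧≡0 (yes p) ¬p = contradiction p ¬p
⟦does⟧≡0 (no _) _ = refl

⟦does⟧*-cong : ∀ {P : Set} (P? : Dec P) {x y} → (P → x ≡ y) → ⟦ does P? ⟧ * x ≡ ⟦ does P? ⟧ * y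
⟦does⟧*-cong (yes p) x≡y = cong (_+ 0) (x≡y p)
⟦does⟧*-cong (no _) _ = refl

*⟦does⟧-pos : ∀ {P : Set} (P? : Dec P) c → 0 < c * ⟦ does P? ⟧ → P
*⟦does⟧-pos (yes p) c _ = p
*⟦does⟧-pos (no _) c 0<c*0 = contradiction (subst (0 <_) (*-zeroʳ c) 0<c*0) λ ()

δ : ∀ {n} → Fin n → Fin n → ℕ
δ i j = ⟦ ⌊ i ≟ j ⌋ ⟧

sum-const : ∀ n k → ∑[ i < n ] k ≡ n * k
sum-const zero k = refl
sum-const (suc n) k = cong (k +_) (sum-const n k)

sum-zero : ∀ {n} {f : Fin n → ℕ} → (∀ i → f i ≡ 0) → sum f ≡ 0
sum-zero {zero} f≡0 = refl
sum-zero {suc n} f≡0 = cong₂ _+_ (f≡0 zero) (sum-zero (f≡0 ∘ suc))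

sum-mono : ∀ {n} {f g : Fin n → ℕ} → (∀ i → f i ≤ g i) → sum f ≤ sum g
sum-mono {zero} f≤g = z≤n
sum-mono {suc n} f≤g = +-mono-≤ (f≤g zero) (sum-mono (f≤g ∘ suc))

term≤sum : ∀ {n} (f : Fin n → ℕ) i → f i ≤ sum f
term≤sum f zero = m≤m+n _ _
term≤sum f (suc i) = ≤-trans (term≤sum (f ∘ suc) i) (m≤n+m _ _)

sum-pos : ∀ {n} (f : Fin n → ℕ) → 0 < sum f → ∃ λ i → 0 < f i
sum-pos {suc n} f 0<sum with f zero in eq
... | suc _ = zero , subst (0 <_) (sym eq) (s≤s z≤n)
... | zero with sum-pos (f ∘ suc) 0<sum
...   | i , 0<fi = suc i , 0<fi

sum-mono-≡ : ∀ {n} {f g : Fin n → ℕ} → (∀ i → f i ≤ g i) → sum f ≡ sum g → ∀ i → f i ≡ g i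
sum-mono-≡ {suc n} {f} {g} f≤g eq zero = ≤-antisym (f≤g zero) (+-cancelʳ-≤ _ _ _ (begin
  g zero + sum (g ∘ suc)  ≡⟨ eq ⟨
  f zero + sum (f ∘ suc)  ≤⟨ +-monoʳ-≤ (f zero) (sum-mono (f≤g ∘ suc)) ⟩
  f zero + sum (g ∘ suc)  ∎))
  where open ≤-Reasoning
sum-mono-≡ {suc n} {f} {g} f≤g eq (suc i) = sum-mono-≡ (f≤g ∘ suc) rest-eq i
  where
  rest-eq : sum (f ∘ suc) ≡ sum (g ∘ suc)
  rest-eq = +-cancelˡ-≡ (g zero) _ _ (trans (cong (_+ sum (f ∘ suc)) (sym (sum-mono-≡ f≤g eq zero))) eq)

two-terms≤sum : ∀ {n} (f : Fin n → ℕ) {i j} → ¬ i ≡ j → 1 ≤ f i → 1 ≤ f j → 2 ≤ sum f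
two-terms≤sum f {zero} {zero} i≢j _ _ = contradiction refl i≢j
two-terms≤sum f {zero} {suc j} _ fi fj = +-mono-≤ fi (≤-trans fj (term≤sum (f ∘ suc) j))
two-terms≤sum f {suc i} {zero} _ fi fj = +-mono-≤ fj (≤-trans fi (term≤sum (f ∘ suc) i))
two-terms≤sum f {suc i} {suc j} i≢j fi fj = ≤-trans (two-terms≤sum (f ∘ suc) (i≢j ∘ cong suc) fi fj) (m≤n+m _ _)

sum-δ : ∀ {n} (p : Fin n) (h : Fin n → ℕ) → ∑[ i < n ] (δ i p * h i) ≡ h p
sum-δ {suc n} zero h = begin
  1 * h zero + ∑[ i < n ] (0 * h (suc i))
    ≡⟨ cong₂ _+_ (*-identityˡ (h zero)) (sum-zero {f = λ i → 0 * h (suc i)} (λ _ → refl)) ⟩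
  h zero + 0
    ≡⟨ +-identityʳ _ ⟩
  h zero ∎
  where open ≡-Reasoning
sum-δ {suc n} (suc p) h = trans (sum-cong-≗ (λ i → cong (_* h (suc i)) (δ-suc i))) (sum-δ p (h ∘ suc))
  where
  δ-suc : ∀ i → δ (suc i) (suc p) ≡ δ i p
  δ-suc i with i ≟ p
  ... | yes _ = refl
  ... | no _ = refl

sum-δ≡1 : ∀ {n} (p : Fin n) → ∑[ i < n ] δ i p ≡ 1
sum-δ≡1 p = trans (sum-cong-≗ (λ i → sym (*-identityʳ (δ i p)))) (sum-δ p (λ _ → 1))

∑∑-permute : ∀ {n} (π : Permutation′ n) (h : Fin n → Fin n → ℕ) →
             ∑[ i < n ] ∑[ j < n ] h (π ⟨$⟩ʳ i) (π ⟨$⟩ʳ j) ≡ ∑[ i < n ] ∑[ j < n ] h i j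
∑∑-permute π h = trans (sum-cong-≗ (λ i → sym (sum-permute (h (π ⟨$⟩ʳ i)) π)))
                       (sym (sum-permute (λ i → sum (h i)) π))

∑Vec : ∀ k l → (Vec (Fin k) l → ℕ) → ℕ
∑Vec k zero g = g []
∑Vec k (suc l) g = ∑[ i < k ] ∑Vec k l (λ v → g (i ∷ v))

module _ {k : ℕ} where

  ∑Vec-cong : ∀ {l} {g h : Vec (Fin k) l → ℕ} → (∀ v → g v ≡ h v) → ∑Vec k l g ≡ ∑Vec k l h
  ∑Vec-cong {zero} g≡h = g≡h []
  ∑Vec-cong {suc l} g≡h = sum-cong-≗ (λ i → ∑Vec-cong (λ v → g≡h (i ∷ v)))

  ∑Vec-distrib-+ : ∀ {l} (g h : Vec (Fin k) l → ℕ) → ∑Vec k l (λ v → g v + h v) ≡ ∑Vec k l g + ∑Vec k l h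
  ∑Vec-distrib-+ {zero} g h = refl
  ∑Vec-distrib-+ {suc l} g h =
    trans (sum-cong-≗ (λ i → ∑Vec-distrib-+ (λ v → g (i ∷ v)) (λ v → h (i ∷ v))))
          (∑-distrib-+ (λ i → ∑Vec k l (λ v → g (i ∷ v))) (λ i → ∑Vec k l (λ v → h (i ∷ v))))

  *-distribˡ-∑Vec : ∀ {l} c (h : Vec (Fin k) l → ℕ) → c * ∑Vec k l h ≡ ∑Vec k l (λ v → c * h v)
  *-distribˡ-∑Vec {zero} c h = refl
  *-distribˡ-∑Vec {suc l} c h =
    trans (*-distribˡ-sum c (λ i → ∑Vec k l (λ v → h (i ∷ v)))) (sum-cong-≗ (λ i → *-distribˡ-∑Vec c (λ v → h (i ∷ v))))

  term≤∑Vec : ∀ {l} (g : Vec (Fin k) l → ℕ) v → g v ≤ ∑Vec k l g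
  term≤∑Vec g [] = ≤-refl
  term≤∑Vec g (i ∷ v) = ≤-trans (term≤∑Vec (λ v → g (i ∷ v)) v) (term≤sum _ i)

  ∑Vec-pos : ∀ {l} (g : Vec (Fin k) l → ℕ) → 0 < ∑Vec k l g → ∃ λ v → 0 < g v
  ∑Vec-pos {zero} g 0<sum = [] , 0<sum
  ∑Vec-pos {suc l} g 0<sum with sum-pos _ 0<sum
  ... | i , 0<rest with ∑Vec-pos (λ v → g (i ∷ v)) 0<rest
  ...   | v , 0<gv = i ∷ v , 0<gv

  ∑Vec-zero : ∀ {l} {g : Vec (Fin k) l → ℕ} → (∀ v → g v ≡ 0) → ∑Vec k l g ≡ 0
  ∑Vec-zero {zero} g≡0 = g≡0 []
  ∑Vec-zero {suc l} g≡0 = sum-zero (λ i → ∑Vec-zero (λ v → g≡0 (i ∷ v)))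

  ∑Vec-comm : ∀ {l n} (f : Vec (Fin k) l → Fin n → ℕ) → ∑Vec k l (λ v → sum (f v)) ≡ ∑[ j < n ] ∑Vec k l (λ v → f v j)
  ∑Vec-comm {zero} f = refl
  ∑Vec-comm {suc l} f =
    trans (sum-cong-≗ (λ i → ∑Vec-comm (λ v → f (i ∷ v)))) (∑-comm (λ i j → ∑Vec k l (λ v → f (i ∷ v) j)))

  ∑Vec-permute : ∀ {l} (π : Permutation′ k) (g : Vec (Fin k) l → ℕ) → ∑Vec k l (g ∘ Vec.map (π ⟨$⟩ʳ_)) ≡ ∑Vec k l g
  ∑Vec-permute {zero} π g = refl
  ∑Vec-permute {suc l} π g = trans (sum-cong-≗ (λ i → ∑Vec-permute π (λ v → g ((π ⟨$⟩ʳ i) ∷ v))))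
                                   (sym (sum-permute (λ j → ∑Vec k l (λ v → g (j ∷ v))) π))

-- Sums over supersets and Möbius inversion

_⊆ᵇ_ : ∀ {m} → Subset m → Subset m → Bool
[] ⊆ᵇ [] = true
(f ∷ F) ⊆ᵇ (t ∷ T) = (not f ∨ t) ∧ (F ⊆ᵇ T)

_≟ₛ_ : ∀ {m} (F G : Subset m) → Dec (F ≡ G)
_≟ₛ_ = ≡-dec Bool._≟_

tabulate-replicate⁻ : ∀ {m} {A : Set} {h : Fin m → A} {x} → tabulate h ≡ replicate m x → ∀ l → h l ≡ x
tabulate-replicate⁻ {h = h} {x} eq l =
  trans (sym (lookup∘tabulate h l)) (trans (cong (λ T → lookup T l) eq) (lookup-replicate l x))

tabulate-replicate : ∀ {m} {A : Set} {h : Fin m → A} {x} → (∀ l → h l ≡ x) → tabulate h ≡ replicate m x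
tabulate-replicate {m} {x = x} h≡x =
  trans (tabulate-cong (λ l → trans (h≡x l) (sym (lookup-replicate l x)))) (tabulate∘lookup (replicate m x))

∅⊆ᵇ : ∀ {m} (T : Subset m) → ∅ ⊆ᵇ T ≡ true
∅⊆ᵇ [] = refl
∅⊆ᵇ (_ ∷ T) = ∅⊆ᵇ T

size : ∀ {m} → Subset m → ℕ
size {m} F = ∑[ l < m ] ⟦ lookup F l ⟧

size≤ : ∀ {m} (F : Subset m) → size F ≤ m
size≤ {m} F = ≤-trans (sum-mono (λ l → ⟦⟧≤1 (lookup F l))) (≤-reflexive (trans (sum-const m 1) (*-identityʳ m)))

size< : ∀ {m} (F : Subset m) → F ≢ ⊤ → size F < m
size< [] F≢⊤ = contradiction refl F≢⊤
size< (true ∷ F) F≢⊤ = s≤s (size< F (F≢⊤ ∘ cong (true ∷_)))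
size< (false ∷ F) _ = s≤s (size≤ F)

∑⊇ : ∀ {m} → (Subset m → ℕ) → Subset m → ℕ
∑⊇ h [] = h []
∑⊇ h (true ∷ F) = ∑⊇ (h ∘ (true ∷_)) F
∑⊇ h (false ∷ F) = ∑⊇ (h ∘ (false ∷_)) F + ∑⊇ (h ∘ (true ∷_)) F

∑⊇-cong : ∀ {m} {g h : Subset m → ℕ} → (∀ G → g G ≡ h G) → ∀ F → ∑⊇ g F ≡ ∑⊇ h F
∑⊇-cong g≡h [] = g≡h []
∑⊇-cong g≡h (true ∷ F) = ∑⊇-cong (g≡h ∘ (true ∷_)) F
∑⊇-cong g≡h (false ∷ F) = cong₂ _+_ (∑⊇-cong (g≡h ∘ (false ∷_)) F) (∑⊇-cong (g≡h ∘ (true ∷_)) F)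

∑⊇-mono : ∀ {m} {g h : Subset m → ℕ} → (∀ G → g G ≤ h G) → ∀ F → ∑⊇ g F ≤ ∑⊇ h F
∑⊇-mono g≤h [] = g≤h []
∑⊇-mono g≤h (true ∷ F) = ∑⊇-mono (g≤h ∘ (true ∷_)) F
∑⊇-mono g≤h (false ∷ F) = +-mono-≤ (∑⊇-mono (g≤h ∘ (false ∷_)) F) (∑⊇-mono (g≤h ∘ (true ∷_)) F)

∑⊇-zero : ∀ {m} (F : Subset m) → ∑⊇ (λ _ → 0) F ≡ 0
∑⊇-zero [] = refl
∑⊇-zero (true ∷ F) = ∑⊇-zero F
∑⊇-zero (false ∷ F) = cong₂ _+_ (∑⊇-zero F) (∑⊇-zero F)

∑⊇-distrib-+ : ∀ {m} (g h : Subset m → ℕ) F → ∑⊇ (λ G → g G + h G) F ≡ ∑⊇ g F + ∑⊇ h F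
∑⊇-distrib-+ g h [] = refl
∑⊇-distrib-+ g h (true ∷ F) = ∑⊇-distrib-+ (g ∘ (true ∷_)) (h ∘ (true ∷_)) F
∑⊇-distrib-+ {suc m} g h (false ∷ F) = begin
  ∑⊇ (λ G → g₀ G + h₀ G) F + ∑⊇ (λ G → g₁ G + h₁ G) F
    ≡⟨ cong₂ _+_ (∑⊇-distrib-+ g₀ h₀ F) (∑⊇-distrib-+ g₁ h₁ F) ⟩
  (∑⊇ g₀ F + ∑⊇ h₀ F) + (∑⊇ g₁ F + ∑⊇ h₁ F)
    ≡⟨ +-interchange (∑⊇ g₀ F) (∑⊇ h₀ F) (∑⊇ g₁ F) (∑⊇ h₁ F) ⟩
  (∑⊇ g₀ F + ∑⊇ g₁ F) + (∑⊇ h₀ F + ∑⊇ h₁ F) ∎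
  where
  open ≡-Reasoning
  g₀ g₁ h₀ h₁ : Subset m → ℕ
  g₀ = g ∘ (false ∷_)
  g₁ = g ∘ (true ∷_)
  h₀ = h ∘ (false ∷_)
  h₁ = h ∘ (true ∷_)

*-distribˡ-∑⊇ : ∀ {m} c (h : Subset m → ℕ) F → c * ∑⊇ h F ≡ ∑⊇ (λ G → c * h G) F
*-distribˡ-∑⊇ c h [] = refl
*-distribˡ-∑⊇ c h (true ∷ F) = *-distribˡ-∑⊇ c (h ∘ (true ∷_)) F
*-distribˡ-∑⊇ c h (false ∷ F) = trans (*-distribˡ-+ c _ _)
  (cong₂ _+_ (*-distribˡ-∑⊇ c (h ∘ (false ∷_)) F) (*-distribˡ-∑⊇ c (h ∘ (true ∷_)) F))

∑⊇-∑Vec : ∀ {m} k l (g : Vec (Fin k) l → Subset m → ℕ) F →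
          ∑⊇ (λ G → ∑Vec k l (λ v → g v G)) F ≡ ∑Vec k l (λ v → ∑⊇ (g v) F)
∑⊇-∑Vec k l g [] = refl
∑⊇-∑Vec k l g (true ∷ F) = ∑⊇-∑Vec k l (λ v → g v ∘ (true ∷_)) F
∑⊇-∑Vec k l g (false ∷ F) =
  trans (cong₂ _+_ (∑⊇-∑Vec k l (λ v → g v ∘ (false ∷_)) F) (∑⊇-∑Vec k l (λ v → g v ∘ (true ∷_)) F))
        (sym (∑Vec-distrib-+ (λ v → ∑⊇ (g v ∘ (false ∷_)) F) (λ v → ∑⊇ (g v ∘ (true ∷_)) F)))

∑⊇-point : ∀ {m} (T F : Subset m) → ∑⊇ (λ G → ⟦ does (T ≟ₛ G) ⟧) F ≡ ⟦ F ⊆ᵇ T ⟧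
∑⊇-point [] [] = refl
∑⊇-point (true ∷ T) (true ∷ F) = ∑⊇-point T F
∑⊇-point (false ∷ T) (true ∷ F) = ∑⊇-zero F
∑⊇-point (true ∷ T) (false ∷ F) = cong₂ _+_ (∑⊇-zero F) (∑⊇-point T F)
∑⊇-point (false ∷ T) (false ∷ F) = trans (cong₂ _+_ (∑⊇-point T F) (∑⊇-zero F)) (+-identityʳ _)

∑⊇-one : ∀ m → ∑⊇ {m} (λ _ → 1) ∅ ≡ 2 ^ m
∑⊇-one zero = refl
∑⊇-one (suc m) = trans (cong₂ _+_ (∑⊇-one m) (∑⊇-one m)) (cong (2 ^ m +_) (sym (+-identityʳ (2 ^ m))))

evenComplement : ∀ {m} → Subset m → Bool
evenComplement [] = true
evenComplement (true ∷ F) = evenComplement F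
evenComplement (false ∷ F) = not (evenComplement F)

∑⊇-evenComplement : ∀ m → ∑⊇ {suc m} (λ G → ⟦ evenComplement G ⟧) ∅ ≡ 2 ^ m
∑⊇-evenComplement m = begin
  ∑⊇ (λ G → ⟦ not (evenComplement G) ⟧) (∅ {m}) + ∑⊇ (λ G → ⟦ evenComplement G ⟧) (∅ {m})
    ≡⟨ ∑⊇-distrib-+ (λ G → ⟦ not (evenComplement G) ⟧) (λ G → ⟦ evenComplement G ⟧) (∅ {m}) ⟨
  ∑⊇ (λ G → ⟦ not (evenComplement G) ⟧ + ⟦ evenComplement G ⟧) (∅ {m})
    ≡⟨ ∑⊇-cong (λ G → ⟦not⟧+⟦⟧ (evenComplement G)) (∅ {m}) ⟩
  ∑⊇ (λ _ → 1) (∅ {m})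
    ≡⟨ ∑⊇-one m ⟩
  2 ^ m ∎
  where open ≡-Reasoning

even-bound : ∀ m (h : Subset m → ℕ) → (∀ F → ⟦ evenComplement F ⟧ ≤ h F) → 2 ^ m ≤ 2 * ∑⊇ h ∅
even-bound zero h even≤h = ≤-trans (even≤h []) (m≤m+n (h []) _)
even-bound (suc m) h even≤h =
  *-monoʳ-≤ 2 (≤-trans (≤-reflexive (sym (∑⊇-evenComplement m))) (∑⊇-mono even≤h ∅))

∑⊇ℤ : ∀ {m} → (Subset m → ℤ) → Subset m → ℤ
∑⊇ℤ h [] = h []
∑⊇ℤ h (true ∷ F) = ∑⊇ℤ (h ∘ (true ∷_)) F
∑⊇ℤ h (false ∷ F) = ∑⊇ℤ (h ∘ (false ∷_)) F ℤ.+ ∑⊇ℤ (h ∘ (true ∷_)) F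

∑⊇ℤ-⊤ : ∀ {m} (h : Subset m → ℤ) → ∑⊇ℤ h ⊤ ≡ h ⊤
∑⊇ℤ-⊤ {zero} h = refl
∑⊇ℤ-⊤ {suc m} h = ∑⊇ℤ-⊤ (h ∘ (true ∷_))

∑⊇ℤ-difference : ∀ {m} (a b : Subset m → ℕ) F →
                 ∑⊇ℤ (λ G → pos (a G) ℤ.- pos (b G)) F ≡ pos (∑⊇ a F) ℤ.- pos (∑⊇ b F)
∑⊇ℤ-difference a b [] = refl
∑⊇ℤ-difference a b (true ∷ F) = ∑⊇ℤ-difference (a ∘ (true ∷_)) (b ∘ (true ∷_)) F
∑⊇ℤ-difference a b (false ∷ F) = begin
  ∑⊇ℤ (λ G → pos (a (false ∷ G)) ℤ.- pos (b (false ∷ G))) F ℤ.+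
  ∑⊇ℤ (λ G → pos (a (true ∷ G)) ℤ.- pos (b (true ∷ G))) F
    ≡⟨ cong₂ ℤ._+_ (∑⊇ℤ-difference (a ∘ (false ∷_)) (b ∘ (false ∷_)) F)
                   (∑⊇ℤ-difference (a ∘ (true ∷_)) (b ∘ (true ∷_)) F) ⟩
  (pos a₀ ℤ.- pos b₀) ℤ.+ (pos a₁ ℤ.- pos b₁)
    ≡⟨ solve 4 (λ a₀ b₀ a₁ b₁ → (a₀ :- b₀) :+ (a₁ :- b₁) := (a₀ :+ a₁) :- (b₀ :+ b₁)) refl
               (pos a₀) (pos b₀) (pos a₁) (pos b₁) ⟩
  (pos a₀ ℤ.+ pos a₁) ℤ.- (pos b₀ ℤ.+ pos b₁)
    ≡⟨ cong₂ ℤ._-_ (ℤ.pos-+ a₀ a₁) (ℤ.pos-+ b₀ b₁) ⟨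
  pos (a₀ + a₁) ℤ.- pos (b₀ + b₁) ∎
  where
  open ≡-Reasoning
  open ℤ-Solver
  a₀ a₁ b₀ b₁ : ℕ
  a₀ = ∑⊇ (a ∘ (false ∷_)) F
  a₁ = ∑⊇ (a ∘ (true ∷_)) F
  b₀ = ∑⊇ (b ∘ (false ∷_)) F
  b₁ = ∑⊇ (b ∘ (true ∷_)) F

sign : ∀ {m} → Subset m → ℤ
sign [] = 1ℤ
sign (true ∷ F) = sign F
sign (false ∷ F) = - sign F

sign-parity : ∀ {m} (F : Subset m) → sign F ≡ (if evenComplement F then 1ℤ else -1ℤ)
sign-parity [] = refl
sign-parity (true ∷ F) = sign-parity F
sign-parity (false ∷ F) = trans (cong -_ (sign-parity F)) (neg-if (evenComplement F))
  where
  neg-if : ∀ e → - (if e then 1ℤ else -1ℤ) ≡ (if not e then 1ℤ else -1ℤ)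
  neg-if true = refl
  neg-if false = refl

sign-squared : ∀ {m} (F : Subset m) → sign F ℤ.* sign F ≡ 1ℤ
sign-squared F rewrite sign-parity F with evenComplement F
... | true = refl
... | false = refl

möbius : ∀ {m} (d : Subset m → ℤ) → (∀ F → F ≢ ⊤ → ∑⊇ℤ d F ≡ 0ℤ) → ∀ F → d F ≡ sign F ℤ.* d ⊤
möbius d vanish [] = sym (ℤ.*-identityˡ (d []))
möbius d vanish (true ∷ F) = möbius (d ∘ (true ∷_)) (λ G G≢⊤ → vanish (true ∷ G) (G≢⊤ ∘ ∷-injectiveʳ)) F
möbius {suc m} d vanish (false ∷ F) = begin
  d₀ F                     ≡⟨ möbius d₀ vanish₀ F ⟩
  sign F ℤ.* d₀ ⊤          ≡⟨ cong (sign F ℤ.*_) d₀⊤≡-d₁⊤ ⟩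
  sign F ℤ.* - d₁ ⊤        ≡⟨ ℤ.neg-distribʳ-* (sign F) (d₁ ⊤) ⟨
  - (sign F ℤ.* d₁ ⊤)      ≡⟨ ℤ.neg-distribˡ-* (sign F) (d₁ ⊤) ⟩
  - sign F ℤ.* d₁ ⊤        ∎
  where
  open ≡-Reasoning
  d₀ d₁ : Subset m → ℤ
  d₀ = d ∘ (false ∷_)
  d₁ = d ∘ (true ∷_)
  vanish₁ : ∀ G → G ≢ ⊤ → ∑⊇ℤ d₁ G ≡ 0ℤ
  vanish₁ G G≢⊤ = vanish (true ∷ G) (G≢⊤ ∘ ∷-injectiveʳ)
  vanish₀ : ∀ G → G ≢ ⊤ → ∑⊇ℤ d₀ G ≡ 0ℤ
  vanish₀ G G≢⊤ = begin
    ∑⊇ℤ d₀ G                  ≡⟨ ℤ.+-identityʳ _ ⟨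
    ∑⊇ℤ d₀ G ℤ.+ 0ℤ           ≡⟨ cong (λ z → ∑⊇ℤ d₀ G ℤ.+ z) (vanish₁ G G≢⊤) ⟨
    ∑⊇ℤ d₀ G ℤ.+ ∑⊇ℤ d₁ G     ≡⟨ vanish (false ∷ G) (λ ()) ⟩
    0ℤ                        ∎
  d₀⊤≡-d₁⊤ : d₀ ⊤ ≡ - d₁ ⊤
  d₀⊤≡-d₁⊤ = ℤ.i-j≡0⇒i≡j _ _ (begin
    d₀ ⊤ ℤ.- - d₁ ⊤              ≡⟨ cong (λ z → d₀ ⊤ ℤ.+ z) (ℤ.neg-involutive (d₁ ⊤)) ⟩
    d₀ ⊤ ℤ.+ d₁ ⊤                ≡⟨ cong₂ ℤ._+_ (∑⊇ℤ-⊤ d₀) (∑⊇ℤ-⊤ d₁) ⟨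
    ∑⊇ℤ d₀ ⊤ ℤ.+ ∑⊇ℤ d₁ ⊤        ≡⟨ vanish (false ∷ ⊤) (λ ()) ⟩
    0ℤ                           ∎)

module SupersetSumsAgree {m : ℕ} (a b : Subset m → ℕ) (agree : ∀ F → F ≢ ⊤ → ∑⊇ a F ≡ ∑⊇ b F) where

  private
    d : Subset m → ℤ
    d G = pos (a G) ℤ.- pos (b G)

    d-sign : ∀ F → d F ≡ sign F ℤ.* d ⊤
    d-sign = möbius d (λ F F≢⊤ → trans (∑⊇ℤ-difference a b F) (ℤ.i≡j⇒i-j≡0 (cong pos (agree F F≢⊤))))

  agree⇒agree-at-⊤ : ∀ F → a F ≡ b F → a ⊤ ≡ b ⊤
  agree⇒agree-at-⊤ F aF≡bF = ℤ.+-injective (ℤ.i-j≡0⇒i≡j _ _ (begin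
    d ⊤                                ≡⟨ ℤ.*-identityˡ (d ⊤) ⟨
    1ℤ ℤ.* d ⊤                         ≡⟨ cong (ℤ._* d ⊤) (sign-squared F) ⟨
    sign F ℤ.* sign F ℤ.* d ⊤          ≡⟨ ℤ.*-assoc (sign F) (sign F) (d ⊤) ⟩
    sign F ℤ.* (sign F ℤ.* d ⊤)        ≡⟨ cong (sign F ℤ.*_) (d-sign F) ⟨
    sign F ℤ.* d F                     ≡⟨ cong (sign F ℤ.*_) (ℤ.i≡j⇒i-j≡0 (cong pos aF≡bF)) ⟩
    sign F ℤ.* 0ℤ                      ≡⟨ ℤ.*-zeroʳ (sign F) ⟩
    0ℤ                                 ∎))
    where open ≡-Reasoning

  vanish-at-⊤⇒even-excess : a ⊤ ≡ 0 → ∀ F → evenComplement F ≡ true → b F ≡ a F + b ⊤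
  vanish-at-⊤⇒even-excess a⊤≡0 F even = ℤ.+-injective (begin
    pos (b F)                           ≡⟨ solve 2 (λ x y → x :- (x :- y) := y) refl (pos (a F)) (pos (b F)) ⟨
    pos (a F) ℤ.- d F                   ≡⟨ cong (λ z → pos (a F) ℤ.- z) dF≡-b⊤ ⟩
    pos (a F) ℤ.- - pos (b ⊤)           ≡⟨ cong (λ z → pos (a F) ℤ.+ z) (ℤ.neg-involutive (pos (b ⊤))) ⟩
    pos (a F) ℤ.+ pos (b ⊤)             ≡⟨ ℤ.pos-+ (a F) (b ⊤) ⟨
    pos (a F + b ⊤)                     ∎)
    where
    open ≡-Reasoning
    open ℤ-Solver
    dF≡-b⊤ : d F ≡ - pos (b ⊤)
    dF≡-b⊤ = begin
      d F                               ≡⟨ d-sign F ⟩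
      sign F ℤ.* d ⊤                    ≡⟨ cong (ℤ._* d ⊤) (trans (sign-parity F) (cong (if_then 1ℤ else -1ℤ) even)) ⟩
      1ℤ ℤ.* d ⊤                        ≡⟨ ℤ.*-identityˡ (d ⊤) ⟩
      pos (a ⊤) ℤ.- pos (b ⊤)           ≡⟨ cong (λ z → pos z ℤ.- pos (b ⊤)) a⊤≡0 ⟩
      0ℤ ℤ.- pos (b ⊤)                  ≡⟨ ℤ.+-identityˡ _ ⟩
      - pos (b ⊤)                       ∎

-- Graphs on Fin N with an enumeration of their edges

Adj : ℕ → Set
Adj N = Fin N → Fin N → Bool

-- Defined exactly as the edge test used by _─_ in Defs, so that deleting a listed edge below
-- agrees definitionally with _─_.
samePair : ∀ {n} → Fin n → Fin n → Fin n → Fin n → Bool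
samePair a b i j = (⌊ i ≟ a ⌋ ∧ ⌊ j ≟ b ⌋) ∨ (⌊ i ≟ b ⌋ ∧ ⌊ j ≟ a ⌋)

removeEdge : ∀ {n} → Adj n → Fin n → Fin n → Adj n
removeEdge g a b i j = g i j ∧ not (samePair a b i j)

_⊆ᴬ_ : ∀ {n} → Adj n → Adj n → Set
g ⊆ᴬ h = ∀ {i j} → g i j ≡ true → h i j ≡ true

Enumerates : ∀ {n m} → (Fin m → Fin n) → (Fin m → Fin n) → Adj n → Set
Enumerates {m = m} a b g = ∀ i j → ⟦ g i j ⟧ ≡ ∑[ k < m ] ⟦ samePair (a k) (b k) i j ⟧

⌊≟⌋-refl : ∀ {n} (i : Fin n) → ⌊ i ≟ i ⌋ ≡ true
⌊≟⌋-refl i with i ≟ i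
... | yes _ = refl
... | no i≢i = contradiction refl i≢i

⌊≟⌋-sym : ∀ {n} (i j : Fin n) → ⌊ i ≟ j ⌋ ≡ ⌊ j ≟ i ⌋
⌊≟⌋-sym i j with i ≟ j | j ≟ i
... | yes _ | yes _ = refl
... | no _ | no _ = refl
... | yes i≡j | no j≢i = contradiction (sym i≡j) j≢i
... | no i≢j | yes j≡i = contradiction (sym j≡i) i≢j

⌊≟⌋-relabel : ∀ {n n′} (π : Permutation n n′) i a → ⌊ (π ⟨$⟩ʳ i) ≟ a ⌋ ≡ ⌊ i ≟ (π ⟨$⟩ˡ a) ⌋
⌊≟⌋-relabel π i a with (π ⟨$⟩ʳ i) ≟ a | i ≟ (π ⟨$⟩ˡ a)
... | yes _ | yes _ = refl
... | no _ | no _ = refl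
... | yes πi≡a | no i≢π⁻¹a = contradiction (trans (sym (inverseˡ π)) (cong (π ⟨$⟩ˡ_) πi≡a)) i≢π⁻¹a
... | no πi≢a | yes i≡π⁻¹a = contradiction (trans (cong (π ⟨$⟩ʳ_) i≡π⁻¹a) (inverseʳ π)) πi≢a

samePair-refl : ∀ {n} (a b : Fin n) → samePair a b a b ≡ true
samePair-refl a b rewrite ⌊≟⌋-refl a | ⌊≟⌋-refl b = refl

samePair-swap : ∀ {n} (a b i j : Fin n) → samePair a b i j ≡ samePair a b j i
samePair-swap a b i j =
  trans (∨-comm (⌊ i ≟ a ⌋ ∧ ⌊ j ≟ b ⌋) _)
        (cong₂ _∨_ (∧-comm (⌊ i ≟ b ⌋) _) (∧-comm (⌊ i ≟ a ⌋) _))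

samePair-flip : ∀ {n} (a b i j : Fin n) → samePair a b i j ≡ samePair i j a b
samePair-flip a b i j =
  trans (cong₂ _∨_ (cong₂ _∧_ (⌊≟⌋-sym i a) (⌊≟⌋-sym j b)) (cong₂ _∧_ (⌊≟⌋-sym i b) (⌊≟⌋-sym j a)))
        (cong ((⌊ a ≟ i ⌋ ∧ ⌊ b ≟ j ⌋) ∨_) (∧-comm (⌊ b ≟ i ⌋) _))

samePair-relabel : ∀ {n n′} (π : Permutation n n′) a b i j →
                   samePair a b (π ⟨$⟩ʳ i) (π ⟨$⟩ʳ j) ≡ samePair (π ⟨$⟩ˡ a) (π ⟨$⟩ˡ b) i j
samePair-relabel π a b i j = cong₂ _∨_ (cong₂ _∧_ (r i a) (r j b)) (cong₂ _∧_ (r i b) (r j a))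
  where
  r : ∀ i a → ⌊ (π ⟨$⟩ʳ i) ≟ a ⌋ ≡ ⌊ i ≟ (π ⟨$⟩ˡ a) ⌋
  r = ⌊≟⌋-relabel π

samePair-true : ∀ {n} {a b i j : Fin n} → samePair a b i j ≡ true → (i ≡ a × j ≡ b) ⊎ (i ≡ b × j ≡ a)
samePair-true {a = a} {b} {i} {j} eq with i ≟ a | j ≟ b | i ≟ b | j ≟ a
... | yes i≡a | yes j≡b | _ | _ = inj₁ (i≡a , j≡b)
... | _ | _ | yes i≡b | yes j≡a = inj₂ (i≡b , j≡a)
samePair-true () | yes _ | no _ | no _ | _
samePair-true () | yes _ | no _ | yes _ | no _
samePair-true () | no _ | _ | no _ | _
samePair-true () | no _ | _ | yes _ | no _

∑∑-samePair : ∀ {n} (c : Fin n → Fin n → ℕ) {a b : Fin n} → ¬ a ≡ b →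
              ∑[ i < n ] ∑[ j < n ] (c i j * ⟦ samePair a b i j ⟧) ≡ c a b + c b a
∑∑-samePair {n} c {a} {b} a≢b = begin
  ∑[ i < n ] ∑[ j < n ] (c i j * ⟦ samePair a b i j ⟧)
    ≡⟨ sum-cong-≗ (λ i → sum-cong-≗ (λ j → split i j)) ⟩
  ∑[ i < n ] ∑[ j < n ] (δ i a * (δ j b * c i j) + δ i b * (δ j a * c i j))
    ≡⟨ sum-cong-≗ (λ i → ∑-distrib-+ (λ j → δ i a * (δ j b * c i j)) (λ j → δ i b * (δ j a * c i j))) ⟩
  ∑[ i < n ] (∑[ j < n ] (δ i a * (δ j b * c i j)) + ∑[ j < n ] (δ i b * (δ j a * c i j)))
    ≡⟨ sum-cong-≗ (λ i → cong₂ _+_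
         (trans (sym (*-distribˡ-sum (δ i a) (λ j → δ j b * c i j))) (cong (δ i a *_) (sum-δ b (c i))))
         (trans (sym (*-distribˡ-sum (δ i b) (λ j → δ j a * c i j))) (cong (δ i b *_) (sum-δ a (c i))))) ⟩
  ∑[ i < n ] (δ i a * c i b + δ i b * c i a)
    ≡⟨ ∑-distrib-+ (λ i → δ i a * c i b) (λ i → δ i b * c i a) ⟩
  ∑[ i < n ] (δ i a * c i b) + ∑[ i < n ] (δ i b * c i a)
    ≡⟨ cong₂ _+_ (sum-δ a (λ i → c i b)) (sum-δ b (λ i → c i a)) ⟩
  c a b + c b a ∎
  where
  open ≡-Reasoning
  indicator : ∀ i j → ⟦ samePair a b i j ⟧ ≡ δ i a * δ j b + δ i b * δ j a
  indicator i j with i ≟ a | j ≟ b | i ≟ b | j ≟ a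
  ... | yes refl | yes refl | yes refl | _ = contradiction refl a≢b
  ... | yes refl | yes refl | no _ | yes refl = contradiction refl a≢b
  ... | yes refl | no _ | yes refl | _ = contradiction refl a≢b
  ... | yes _ | yes _ | no _ | no _ = refl
  ... | yes _ | no _ | no _ | yes _ = refl
  ... | yes _ | no _ | no _ | no _ = refl
  ... | no _ | yes _ | yes _ | yes _ = refl
  ... | no _ | no _ | yes _ | yes _ = refl
  ... | no _ | yes _ | yes _ | no _ = refl
  ... | no _ | no _ | yes _ | no _ = refl
  ... | no _ | yes _ | no _ | yes _ = refl
  ... | no _ | yes _ | no _ | no _ = refl
  ... | no _ | no _ | no _ | yes _ = refl
  ... | no _ | no _ | no _ | no _ = refl
  split : ∀ i j → c i j * ⟦ samePair a b i j ⟧ ≡ δ i a * (δ j b * c i j) + δ i b * (δ j a * c i j)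
  split i j = trans (cong (c i j *_) (indicator i j))
                    (solve 5 (λ c x y z w → c :* (x :* y :+ z :* w) := x :* (y :* c) :+ z :* (w :* c)) refl
                           (c i j) (δ i a) (δ j b) (δ i b) (δ j a))
    where open ℕ-Solver

samePair-respects : ∀ {n} {A : Set} (f : Fin n → Fin n → A) → (∀ c d → f c d ≡ f d c) →
                    ∀ {a b c d} → samePair a b c d ≡ true → f c d ≡ f a b
samePair-respects f f-sym {a} {b} {c} {d} eq with samePair-true {a = a} {b} {c} {d} eq
... | inj₁ (refl , refl) = refl
... | inj₂ (refl , refl) = f-sym b a

removeEdge⊆ : ∀ {n} (g : Adj n) a b → removeEdge g a b ⊆ᴬ g
removeEdge⊆ g a b {i} {j} eq with g i j
... | true = refl
... | false = eq

removeEdge-removed : ∀ {n} (g : Adj n) a b {c d} → removeEdge g a b c d ≡ true → samePair a b c d ≡ false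
removeEdge-removed g a b {c} {d} eq with g c d | samePair a b c d
... | true | false = refl
... | true | true = contradiction eq λ ()
... | false | _ = contradiction eq λ ()

removeEdge-kept : ∀ {n} (g : Adj n) a b {c d} → g c d ≡ true → samePair a b c d ≡ false → removeEdge g a b c d ≡ true
removeEdge-kept g a b gcd ab≢cd rewrite gcd | ab≢cd = refl

removeEdge-symmetric : ∀ {n} (g : Adj n) → (∀ c d → g c d ≡ g d c) →
                       ∀ a b c d → removeEdge g a b c d ≡ removeEdge g a b d c
removeEdge-symmetric g g-sym a b c d = cong₂ (λ u v → u ∧ not v) (g-sym c d) (samePair-swap a b c d)

record ListedGraph (N m : ℕ) : Set where
  field
    adjacent : Adj N
    symmetric : ∀ i j → adjacent i j ≡ adjacent j i
    irreflexive : ∀ i → adjacent i i ≡ false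
    src tgt : Fin m → Fin N
    enumerates : Enumerates src tgt adjacent

  card : Fin m → Adj N
  card k = removeEdge adjacent (src k) (tgt k)

  listed-adjacent : ∀ k → adjacent (src k) (tgt k) ≡ true
  listed-adjacent k with adjacent (src k) (tgt k) in eq
  ... | true = refl
  ... | false = contradiction (begin
      1                                            ≡⟨ cong ⟦_⟧ (samePair-refl (src k) (tgt k)) ⟨
      ⟦ samePair (src k) (tgt k) (src k) (tgt k) ⟧  ≤⟨ term≤sum (λ l → ⟦ samePair (src l) (tgt l) (src k) (tgt k) ⟧) k ⟩
      ∑[ l < m ] ⟦ samePair (src l) (tgt l) (src k) (tgt k) ⟧ ≡⟨ enumerates (src k) (tgt k) ⟨
      ⟦ adjacent (src k) (tgt k) ⟧                  ≡⟨ cong ⟦_⟧ eq ⟩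
      0                                            ∎) λ ()
    where open ≤-Reasoning

  src≢tgt : ∀ k → ¬ src k ≡ tgt k
  src≢tgt k eq with trans (sym (listed-adjacent k)) (trans (cong (λ i → adjacent i (tgt k)) eq) (irreflexive (tgt k)))
  ... | ()

  index : ∀ {i j} → adjacent i j ≡ true → ∃ λ k → samePair (src k) (tgt k) i j ≡ true
  index {i} {j} i~j with sum-pos (λ k → ⟦ samePair (src k) (tgt k) i j ⟧)
                                 (subst (0 <_) (trans (cong ⟦_⟧ (sym i~j)) (enumerates i j)) (s≤s z≤n))
  ... | k , 0<term = k , ⟦⟧-pos 0<term

  index-unique : ∀ {i j k l} → samePair (src k) (tgt k) i j ≡ true → samePair (src l) (tgt l) i j ≡ true → k ≡ l
  index-unique {i} {j} {k} {l} kij lij with k ≟ l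
  ... | yes k≡l = k≡l
  ... | no k≢l = contradiction (begin
      2
        ≤⟨ two-terms≤sum (λ k → ⟦ samePair (src k) (tgt k) i j ⟧) k≢l
             (≤-reflexive (cong ⟦_⟧ (sym kij))) (≤-reflexive (cong ⟦_⟧ (sym lij))) ⟩
      ∑[ k < m ] ⟦ samePair (src k) (tgt k) i j ⟧
        ≡⟨ enumerates i j ⟨
      ⟦ adjacent i j ⟧
        ≤⟨ ⟦⟧≤1 _ ⟩
      1 ∎) (λ { (s≤s ()) })
    where open ≤-Reasoning

  handshake : ∀ (c : Fin N → Fin N → ℕ) →
              ∑[ i < N ] ∑[ j < N ] (c i j * ⟦ adjacent i j ⟧) ≡ ∑[ k < m ] (c (src k) (tgt k) + c (tgt k) (src k))
  handshake c = begin
    ∑[ i < N ] ∑[ j < N ] (c i j * ⟦ adjacent i j ⟧)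
      ≡⟨ sum-cong-≗ (λ i → sum-cong-≗ (λ j → trans (cong (c i j *_) (enumerates i j))
                                                  (*-distribˡ-sum (c i j) (λ k → ⟦ samePair (src k) (tgt k) i j ⟧)))) ⟩
    ∑[ i < N ] ∑[ j < N ] ∑[ k < m ] (c i j * ⟦ samePair (src k) (tgt k) i j ⟧)
      ≡⟨ sum-cong-≗ (λ i → ∑-comm (λ j k → c i j * ⟦ samePair (src k) (tgt k) i j ⟧)) ⟩
    ∑[ i < N ] ∑[ k < m ] ∑[ j < N ] (c i j * ⟦ samePair (src k) (tgt k) i j ⟧)
      ≡⟨ ∑-comm (λ i k → ∑[ j < N ] (c i j * ⟦ samePair (src k) (tgt k) i j ⟧)) ⟩
    ∑[ k < m ] ∑[ i < N ] ∑[ j < N ] (c i j * ⟦ samePair (src k) (tgt k) i j ⟧)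
      ≡⟨ sum-cong-≗ (λ k → ∑∑-samePair c (src≢tgt k)) ⟩
    ∑[ k < m ] (c (src k) (tgt k) + c (tgt k) (src k)) ∎
    where open ≡-Reasoning

  edge-count : ∑[ i < N ] ∑[ j < N ] ⟦ adjacent i j ⟧ ≡ m * 2
  edge-count = trans (sum-cong-≗ (λ i → sum-cong-≗ (λ j → sym (*-identityˡ ⟦ adjacent i j ⟧))))
                     (trans (handshake (λ _ _ → 1)) (sum-const m 2))

  on-every-edge : {P : Fin N → Fin N → Set} → (∀ {i j} → P i j → P j i) → (∀ k → P (src k) (tgt k)) →
                  ∀ {i j} → adjacent i j ≡ true → P i j
  on-every-edge {P} P-sym P-listed {i} {j} i~j with index i~j
  ... | k , kij with samePair-true {a = src k} {tgt k} {i} {j} kij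
  ...   | inj₁ (refl , refl) = P-listed k
  ...   | inj₂ (refl , refl) = P-sym (P-listed k)

relabel : ∀ {N N′ m} → ListedGraph N m → Permutation N N′ → ListedGraph N′ m
relabel {m = m} G ρ = record
  { adjacent = λ i j → adjacent (ρ ⟨$⟩ˡ i) (ρ ⟨$⟩ˡ j)
  ; symmetric = λ i j → symmetric _ _
  ; irreflexive = λ i → irreflexive _
  ; src = (ρ ⟨$⟩ʳ_) ∘ src
  ; tgt = (ρ ⟨$⟩ʳ_) ∘ tgt
  ; enumerates = λ i j →
      trans (enumerates _ _) (sum-cong-≗ (λ k → cong ⟦_⟧ (samePair-relabel (flip ρ) (src k) (tgt k) i j)))
  }
  where open ListedGraph G

card-relabel : ∀ {N N′ m} (G : ListedGraph N m) (ρ : Permutation N N′) k i j →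
               ListedGraph.card (relabel G ρ) k i j ≡ ListedGraph.card G k (ρ ⟨$⟩ˡ i) (ρ ⟨$⟩ˡ j)
card-relabel G ρ k i j = cong (λ z → ListedGraph.adjacent G (ρ ⟨$⟩ˡ i) (ρ ⟨$⟩ˡ j) ∧ not z)
  (sym (samePair-relabel (flip ρ) (ListedGraph.src G k) (ListedGraph.tgt G k) i j))

adjacency-count-relabel : ∀ {N m} (H : ListedGraph N m) (π : Permutation′ N) →
                          ∑[ i < N ] ∑[ j < N ] ⟦ ListedGraph.adjacent H (π ⟨$⟩ʳ i) (π ⟨$⟩ʳ j) ⟧ ≡ m * 2
adjacency-count-relabel H π = trans (∑∑-permute π (λ i j → ⟦ ListedGraph.adjacent H i j ⟧)) (ListedGraph.edge-count H)

edges-onto-edges⇒iso : ∀ {N m} (G H : ListedGraph N m) (π : Permutation′ N) →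
  (∀ k → ListedGraph.adjacent H (π ⟨$⟩ʳ ListedGraph.src G k) (π ⟨$⟩ʳ ListedGraph.tgt G k) ≡ true) →
  ∀ i j → ListedGraph.adjacent G i j ≡ ListedGraph.adjacent H (π ⟨$⟩ʳ i) (π ⟨$⟩ʳ j)
edges-onto-edges⇒iso {N} G H π onto i j =
  ⟦⟧-injective (sum-mono-≡ (pointwise i) (sum-mono-≡ (λ i′ → sum-mono (pointwise i′)) same-count i) j)
  where
  g h : Adj N
  g = ListedGraph.adjacent G
  h = ListedGraph.adjacent H
  pointwise : ∀ i j → ⟦ g i j ⟧ ≤ ⟦ h (π ⟨$⟩ʳ i) (π ⟨$⟩ʳ j) ⟧
  pointwise i j with g i j in gij
  ... | false = z≤n
  ... | true = ≤-reflexive (cong ⟦_⟧ (sym (ListedGraph.on-every-edge G (trans (ListedGraph.symmetric H _ _)) onto gij)))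
  same-count : ∑[ i < N ] ∑[ j < N ] ⟦ g i j ⟧ ≡ ∑[ i < N ] ∑[ j < N ] ⟦ h (π ⟨$⟩ʳ i) (π ⟨$⟩ʳ j) ⟧
  same-count = trans (ListedGraph.edge-count G) (sym (adjacency-count-relabel H π))

-- Kelly's lemma

every : ∀ m → (Fin m → Bool) → Bool
every zero h = true
every (suc m) h = h zero ∧ every m (h ∘ suc)

every-cong : ∀ {m} {g h : Fin m → Bool} → (∀ l → g l ≡ h l) → every m g ≡ every m h
every-cong {zero} g≡h = refl
every-cong {suc m} g≡h = cong₂ _∧_ (g≡h zero) (every-cong (g≡h ∘ suc))

every-true : ∀ {m} {h : Fin m → Bool} → (∀ l → h l ≡ true) → every m h ≡ true
every-true {zero} all = refl
every-true {suc m} {h} all rewrite all zero = every-true (all ∘ suc)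

every-false : ∀ {m} {h : Fin m → Bool} l → h l ≡ false → every m h ≡ false
every-false {suc m} {h} zero hl rewrite hl = refl
every-false {suc m} {h} (suc l) hl with h zero
... | true = every-false l hl
... | false = refl

every-elim : ∀ {m} {h : Fin m → Bool} → every m h ≡ true → ∀ l → h l ≡ true
every-elim {h = h} all l with h l in hl
... | true = refl
... | false = trans (sym (every-false l hl)) all

every-∧ : ∀ {m} (g h : Fin m → Bool) → every m (λ l → g l ∧ h l) ≡ every m g ∧ every m h
every-∧ {zero} g h = refl
every-∧ {suc m} g h rewrite every-∧ (g ∘ suc) (h ∘ suc) =
  interchange (g zero) (h zero) (every m (g ∘ suc)) (every m (h ∘ suc))
  where
  interchange : ∀ a b c d → (a ∧ b) ∧ (c ∧ d) ≡ (a ∧ c) ∧ (b ∧ d)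
  interchange true true c d = refl
  interchange true false c d = sym (∧-zeroʳ c)
  interchange false b c d = refl

⊆ᵇ-tabulate : ∀ {m} (F : Subset m) (h : Fin m → Bool) →
              F ⊆ᵇ tabulate h ≡ every m (λ l → not (lookup F l) ∨ h l)
⊆ᵇ-tabulate [] h = refl
⊆ᵇ-tabulate (f ∷ F) h = cong ((not f ∨ h zero) ∧_) (⊆ᵇ-tabulate F (h ∘ suc))

at-most-one⇒none+count : ∀ {m} (h : Fin m → Bool) → ∑[ l < m ] ⟦ h l ⟧ ≤ 1 →
                        ⟦ every m (not ∘ h) ⟧ + ∑[ l < m ] ⟦ h l ⟧ ≡ 1
at-most-one⇒none+count {m} h ≤1 with ∑[ l < m ] ⟦ h l ⟧ in count
... | zero = cong (_+ 0) (cong ⟦_⟧ (every-true none))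
  where
  none : ∀ l → not (h l) ≡ true
  none l with h l in hl
  ... | false = refl
  ... | true = contradiction
    (subst (1 ≤_) count (subst (_≤ ∑[ l < m ] ⟦ h l ⟧) (cong ⟦_⟧ hl) (term≤sum (λ l → ⟦ h l ⟧) l))) λ ()
... | suc zero with sum-pos (λ l → ⟦ h l ⟧) (≤-reflexive (sym count))
...   | l , 0<term = cong (_+ 1) (cong ⟦_⟧ (every-false l (cong not (⟦⟧-pos 0<term))))
at-most-one⇒none+count h (s≤s ()) | suc (suc _)

trace : ∀ {N m} → ListedGraph N m → Adj N → (Fin N → Fin N) → Subset m
trace X g σ = tabulate (λ l → g (σ (src l)) (σ (tgt l)))
  where open ListedGraph X

module _ {N m m′ : ℕ} (X : ListedGraph N m) (G : ListedGraph N m′) (π : Permutation′ N) where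

  open ListedGraph X using () renaming (src to a; tgt to b)
  open ListedGraph G using (card) renaming (adjacent to g; src to p; tgt to q)

  private
    σ : Fin N → Fin N
    σ = π ⟨$⟩ʳ_

  module _ (F : Subset m) where

    private
      f onto : Fin m → Bool
      f = lookup F
      onto l = g (σ (a l)) (σ (b l))
      hits : Fin m′ → Fin m → Bool
      hits k l = samePair (p k) (q k) (σ (a l)) (σ (b l))
      F⊆image : Bool
      F⊆image = every m (λ l → not (f l) ∨ onto l)
      avoids : Fin m′ → Bool
      avoids k = every m (λ l → not (f l ∧ hits k l))

      ⊆ᵇ-trace-card : ∀ k → F ⊆ᵇ trace X (card k) σ ≡ F⊆image ∧ avoids k
      ⊆ᵇ-trace-card k = trans (⊆ᵇ-tabulate F _)
        (trans (every-cong (λ l → distrib (f l) (onto l) (hits k l)))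
               (every-∧ (λ l → not (f l) ∨ onto l) (λ l → not (f l ∧ hits k l))))
        where
        distrib : ∀ x y z → not x ∨ (y ∧ not z) ≡ (not x ∨ y) ∧ not (x ∧ z)
        distrib true y z = refl
        distrib false y z = refl

      hit-at-most-once : ∀ k → ∑[ l < m ] ⟦ f l ∧ hits k l ⟧ ≤ 1
      hit-at-most-once k = begin
        ∑[ l < m ] ⟦ f l ∧ hits k l ⟧
          ≤⟨ sum-mono (λ l → ⟦∧⟧≤ (f l) (hits k l)) ⟩
        ∑[ l < m ] ⟦ hits k l ⟧
          ≡⟨ sum-cong-≗ (λ l → cong ⟦_⟧ (trans (samePair-relabel π (p k) (q k) (a l) (b l))
                                                (samePair-flip _ _ (a l) (b l)))) ⟩
        ∑[ l < m ] ⟦ samePair (a l) (b l) (π ⟨$⟩ˡ p k) (π ⟨$⟩ˡ q k) ⟧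
          ≡⟨ ListedGraph.enumerates X _ _ ⟨
        ⟦ ListedGraph.adjacent X (π ⟨$⟩ˡ p k) (π ⟨$⟩ˡ q k) ⟧
          ≤⟨ ⟦⟧≤1 _ ⟩
        1 ∎
        where
        open ≤-Reasoning
        ⟦∧⟧≤ : ∀ x y → ⟦ x ∧ y ⟧ ≤ ⟦ y ⟧
        ⟦∧⟧≤ true y = ≤-refl
        ⟦∧⟧≤ false y = z≤n

      hit-count : F⊆image ≡ true →
                  ∑[ k < m′ ] ∑[ l < m ] ⟦ f l ∧ hits k l ⟧ ≡ size F
      hit-count F⊆trace = trans (∑-comm (λ k l → ⟦ f l ∧ hits k l ⟧)) (sum-cong-≗ hit-once)
        where
        hit-once : ∀ l → ∑[ k < m′ ] ⟦ f l ∧ hits k l ⟧ ≡ ⟦ f l ⟧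
        hit-once l = begin
          ∑[ k < m′ ] ⟦ f l ∧ hits k l ⟧        ≡⟨ sum-cong-≗ (λ k → ⟦∧⟧ (f l) (hits k l)) ⟩
          ∑[ k < m′ ] (⟦ f l ⟧ * ⟦ hits k l ⟧)  ≡⟨ *-distribˡ-sum ⟦ f l ⟧ (λ k → ⟦ hits k l ⟧) ⟨
          ⟦ f l ⟧ * ∑[ k < m′ ] ⟦ hits k l ⟧    ≡⟨ cong (⟦ f l ⟧ *_) (ListedGraph.enumerates G _ _) ⟨
          ⟦ f l ⟧ * ⟦ onto l ⟧                  ≡⟨ absorb (f l) (onto l) (every-elim F⊆trace l) ⟩
          ⟦ f l ⟧                               ∎
          where
          open ≡-Reasoning
          absorb : ∀ x y → not x ∨ y ≡ true → ⟦ x ⟧ * ⟦ y ⟧ ≡ ⟦ x ⟧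
          absorb true true _ = refl
          absorb false y _ = refl

    -- Each edge of F lands on exactly one edge of G and distinct edges on distinct ones, so if
    -- the whole of F lands on edges of G then exactly m′ − |F| cards of G still contain its image.
    kelly : ∑[ k < m′ ] ⟦ F ⊆ᵇ trace X (card k) σ ⟧ + size F * ⟦ F ⊆ᵇ trace X g σ ⟧ ≡ m′ * ⟦ F ⊆ᵇ trace X g σ ⟧
    kelly rewrite ⊆ᵇ-tabulate F onto with every m (λ l → not (f l) ∨ onto l) in F⊆trace
    ... | false = begin
      ∑[ k < m′ ] ⟦ F ⊆ᵇ trace X (card k) σ ⟧ + size F * 0
        ≡⟨ cong₂ _+_ (sum-zero (λ k → cong ⟦_⟧ (trans (⊆ᵇ-trace-card k) (cong (_∧ avoids k) F⊆trace))))
                     (*-zeroʳ (size F)) ⟩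
      0
        ≡⟨ *-zeroʳ m′ ⟨
      m′ * 0 ∎
      where open ≡-Reasoning
    ... | true = begin
      ∑[ k < m′ ] ⟦ F ⊆ᵇ trace X (card k) σ ⟧ + size F * 1
        ≡⟨ cong₂ _+_ (sum-cong-≗ (λ k → cong ⟦_⟧ (trans (⊆ᵇ-trace-card k) (cong (_∧ avoids k) F⊆trace))))
                     (*-identityʳ (size F)) ⟩
      ∑[ k < m′ ] ⟦ avoids k ⟧ + size F
        ≡⟨ cong (∑[ k < m′ ] ⟦ avoids k ⟧ +_) (hit-count F⊆trace) ⟨
      ∑[ k < m′ ] ⟦ avoids k ⟧ + ∑[ k < m′ ] ∑[ l < m ] ⟦ f l ∧ hits k l ⟧
        ≡⟨ ∑-distrib-+ (λ k → ⟦ avoids k ⟧) (λ k → ∑[ l < m ] ⟦ f l ∧ hits k l ⟧) ⟨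
      ∑[ k < m′ ] (⟦ avoids k ⟧ + ∑[ l < m ] ⟦ f l ∧ hits k l ⟧)
        ≡⟨ sum-cong-≗ (λ k → at-most-one⇒none+count (λ l → f l ∧ hits k l) (hit-at-most-once k)) ⟩
      ∑[ k < m′ ] 1
        ≡⟨ sum-const m′ 1 ⟩
      m′ * 1 ∎
      where open ≡-Reasoning

-- Automorphisms of K s t

module _ {A : Set} {P : A → Set} (P? : Decidable P) where

  length-filter-∷ : ∀ x xs → length (filter P? (x ∷ xs)) ≡ ⟦ does (P? x) ⟧ + length (filter P? xs)
  length-filter-∷ x xs with does (P? x)
  ... | true = refl
  ... | false = refl

  length-filter-++ : ∀ xs ys → length (filter P? (xs ++ ys)) ≡ length (filter P? xs) + length (filter P? ys)
  length-filter-++ xs ys = trans (cong length (filter-++ P? xs ys)) (length-++ (filter P? xs))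

  length-filter-concatMap : ∀ {B : Set} {k} (h : B → List A) (g : Fin k → B) →
                            length (filter P? (concatMap h (List.tabulate g))) ≡ ∑[ i < k ] length (filter P? (h (g i)))
  length-filter-concatMap {k = zero} h g = refl
  length-filter-concatMap {k = suc k} h g = trans (length-filter-++ (h (g zero)) _)
    (cong (length (filter P? (h (g zero))) +_) (length-filter-concatMap h (g ∘ suc)))

length-filter-map : ∀ {A B : Set} {P : B → Set} (P? : Decidable P) (f : A → B) xs →
                    length (filter P? (map f xs)) ≡ length (filter (P? ∘ f) xs)
length-filter-map P? f [] = refl
length-filter-map P? f (x ∷ xs) = begin
  length (filter P? (f x ∷ map f xs))              ≡⟨ length-filter-∷ P? (f x) (map f xs) ⟩
  ⟦ does (P? (f x)) ⟧ + length (filter P? (map f xs)) ≡⟨ cong (⟦ does (P? (f x)) ⟧ +_) (length-filter-map P? f xs) ⟩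
  ⟦ does (P? (f x)) ⟧ + length (filter (P? ∘ f) xs)   ≡⟨ length-filter-∷ (P? ∘ f) x xs ⟨
  length (filter (P? ∘ f) (x ∷ xs))                ∎
  where open ≡-Reasoning

length-filter-allVecs : ∀ k l {P : Vec (Fin k) l → Set} (P? : Decidable P) →
                        length (filter P? (allVecs k l)) ≡ ∑Vec k l (λ v → ⟦ does (P? v) ⟧)
length-filter-allVecs k zero P? = trans (length-filter-∷ P? [] []) (+-identityʳ _)
length-filter-allVecs k (suc l) P? = trans (length-filter-concatMap P? (λ i → map (i ∷_) (allVecs k l)) id)
  (sum-cong-≗ (λ i → trans (length-filter-map P? (i ∷_) (allVecs k l)) (length-filter-allVecs k l (P? ∘ (i ∷_)))))

injective⇒surjective : ∀ {n} (f : Fin n → Fin n) → Injective _≡_ _≡_ f → ∀ y → ∃ λ x → f x ≡ y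
injective⇒surjective {n} f f-inj y with any? (λ x → f x ≟ y)
... | yes found = found
injective⇒surjective {suc n} f f-inj y | no missed = contradiction (injective⇒≤ g-inj) 1+n≰n
  where
  avoids : ∀ x → ¬ y ≡ f x
  avoids x y≡fx = missed (x , sym y≡fx)
  g : Fin (suc n) → Fin n
  g x = punchOut (avoids x)
  g-inj : Injective _≡_ _≡_ g
  g-inj eq = f-inj (punchOut-injective (avoids _) (avoids _) eq)

injective⇒permutation : ∀ {n} (f : Fin n → Fin n) → Injective _≡_ _≡_ f → Permutation′ n
injective⇒permutation f f-inj = permutation f (proj₁ ∘ surj) (proj₂ ∘ surj) (λ x → f-inj (proj₂ (surj (f x))))
  where
  surj : ∀ y → ∃ λ x → f x ≡ y
  surj = injective⇒surjective f f-inj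

⌊<?⌋-suc : ∀ a b → ⌊ suc a <? suc b ⌋ ≡ ⌊ a <? b ⌋
⌊<?⌋-suc a b with a <? b | suc a <? suc b
... | yes _ | yes _ = refl
... | no _ | no _ = refl
... | yes a<b | no a≮b = contradiction (s≤s a<b) a≮b
... | no a≮b | yes a<b = contradiction (s≤s⁻¹ a<b) a≮b

count-below : ∀ s t → ∑[ i < s + t ] ⟦ ⌊ toℕ i <? s ⌋ ⟧ ≡ s
count-below zero t = sum-zero {n = t} {f = λ i → ⟦ ⌊ toℕ i <? 0 ⌋ ⟧} (λ _ → refl)
count-below (suc s) t = cong suc (trans (sum-cong-≗ {n = s + t} {x = λ i → ⟦ ⌊ suc (toℕ i) <? suc s ⌋ ⟧}
  (λ i → cong ⟦_⟧ (⌊<?⌋-suc (toℕ i) s))) (count-below s t))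

count-notBelow : ∀ s t → ∑[ i < s + t ] ⟦ not ⌊ toℕ i <? s ⌋ ⟧ ≡ t
count-notBelow zero zero = refl
count-notBelow zero (suc t) = cong suc (count-notBelow zero t)
count-notBelow (suc s) t = trans (sum-cong-≗ {n = s + t} {x = λ i → ⟦ not ⌊ suc (toℕ i) <? suc s ⌋ ⟧}
  (λ i → cong (⟦_⟧ ∘ not) (⌊<?⌋-suc (toℕ i) s))) (count-notBelow s t)

module CompleteBipartite (s t : ℕ) where

  N : ℕ
  N = s + t

  -- Verbatim the side test inside K in Defs (with ⌊_⌋, not does), so that adj (K s t) i j is
  -- inA i xor inA j by definition.
  inA : Fin N → Bool
  inA i = ⌊ toℕ i <? s ⌋

  PreservesSides : (Fin N → Fin N) → Set
  PreservesSides u = ∀ i j → adj (K s t) i j ≡ adj (K s t) (u i) (u j)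

  aut : Vec (Fin N) N → ℕ
  aut v = ⟦ does (isAut? (K s t) v) ⟧

  autOrder≡∑aut : autOrder (K s t) ≡ ∑Vec N N aut
  autOrder≡∑aut = length-filter-allVecs N N (isAut? (K s t))

  aut≡1 : ∀ {v} → IsAut (K s t) v → aut v ≡ 1
  aut≡1 {v} = ⟦does⟧≡1 (isAut? (K s t) v)

  aut-pos : ∀ {v} c → 0 < c * aut v → IsAut (K s t) v
  aut-pos {v} = *⟦does⟧-pos (isAut? (K s t) v)

  autPermutation : ∀ {v} → IsAut (K s t) v → Permutation′ N
  autPermutation {v} (inj , _) = injective⇒permutation (lookup v) (inj _ _)

  autPermutation-preservesSides : ∀ {v} (isAut : IsAut (K s t) v) →
                                  PreservesSides (autPermutation {v} isAut ⟨$⟩ʳ_)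
  autPermutation-preservesSides (_ , preserves) = preserves

  aut-relabel : ∀ (π : Permutation′ N) → PreservesSides (π ⟨$⟩ʳ_) → ∀ v → aut (Vec.map (π ⟨$⟩ʳ_) v) ≡ aut v
  aut-relabel π π-sides v = cong ⟦_⟧ (does-⇔ (mk⇔ to from) (isAut? (K s t) (Vec.map (π ⟨$⟩ʳ_) v)) (isAut? (K s t) v))
    where
    u : Fin N → Fin N
    u = π ⟨$⟩ʳ_
    lookup-u : ∀ i → lookup (Vec.map u v) i ≡ u (lookup v i)
    lookup-u i = Vec.lookup-map i u v
    to : IsAut (K s t) (Vec.map u v) → IsAut (K s t) v
    to (inj , pres) =
        (λ i j eq → inj i j (trans (lookup-u i) (trans (cong u eq) (sym (lookup-u j)))))
      , (λ i j → trans (pres i j) (trans (cong₂ (adj (K s t)) (lookup-u i) (lookup-u j)) (sym (π-sides _ _))))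
    from : IsAut (K s t) v → IsAut (K s t) (Vec.map u v)
    from (inj , pres) =
        (λ i j eq → inj i j (trans (sym (inverseˡ π))
                              (trans (cong (π ⟨$⟩ˡ_) (trans (sym (lookup-u i)) (trans eq (lookup-u j)))) (inverseˡ π))))
      , (λ i j → trans (pres i j) (trans (π-sides _ _) (sym (cong₂ (adj (K s t)) (lookup-u i) (lookup-u j)))))

  aut-identity : aut (Vec.allFin N) ≡ 1
  aut-identity = aut≡1 {Vec.allFin N}
    ( (λ i j eq → trans (sym (Vec.lookup-allFin i)) (trans eq (Vec.lookup-allFin j)))
    , (λ i j → sym (cong₂ (adj (K s t)) (Vec.lookup-allFin i) (Vec.lookup-allFin j))))

  1≤∑aut : 1 ≤ ∑Vec N N aut
  1≤∑aut = ≤-trans (≤-reflexive (sym aut-identity)) (term≤∑Vec aut (Vec.allFin N))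

  edge-count-K : ∑[ i < N ] ∑[ j < N ] ⟦ adj (K s t) i j ⟧ ≡ s * t + t * s
  edge-count-K = begin
    ∑[ i < N ] ∑[ j < N ] ⟦ inA i xor inA j ⟧
      ≡⟨ sum-cong-≗ (λ i → sum-cong-≗ (λ j → ⟦xor⟧ (inA i) (inA j))) ⟩
    ∑[ i < N ] ∑[ j < N ] (⟦ inA i ⟧ * ⟦ not (inA j) ⟧ + ⟦ not (inA i) ⟧ * ⟦ inA j ⟧)
      ≡⟨ sum-cong-≗ (λ i → ∑-distrib-+ (λ j → ⟦ inA i ⟧ * ⟦ not (inA j) ⟧) (λ j → ⟦ not (inA i) ⟧ * ⟦ inA j ⟧)) ⟩
    ∑[ i < N ] (∑[ j < N ] (⟦ inA i ⟧ * ⟦ not (inA j) ⟧) + ∑[ j < N ] (⟦ not (inA i) ⟧ * ⟦ inA j ⟧))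
      ≡⟨ sum-cong-≗ (λ i → cong₂ _+_
           (trans (sym (*-distribˡ-sum ⟦ inA i ⟧ (λ j → ⟦ not (inA j) ⟧)))
                  (cong (⟦ inA i ⟧ *_) (count-notBelow s t)))
           (trans (sym (*-distribˡ-sum ⟦ not (inA i) ⟧ (λ j → ⟦ inA j ⟧)))
                  (cong (⟦ not (inA i) ⟧ *_) (count-below s t)))) ⟩
    ∑[ i < N ] (⟦ inA i ⟧ * t + ⟦ not (inA i) ⟧ * s)
      ≡⟨ ∑-distrib-+ (λ i → ⟦ inA i ⟧ * t) (λ i → ⟦ not (inA i) ⟧ * s) ⟩
    ∑[ i < N ] (⟦ inA i ⟧ * t) + ∑[ i < N ] (⟦ not (inA i) ⟧ * s)
      ≡⟨ cong₂ _+_ (trans (sym (*-distribʳ-sum t (λ i → ⟦ inA i ⟧))) (cong (_* t) (count-below s t)))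
                   (trans (sym (*-distribʳ-sum s (λ i → ⟦ not (inA i) ⟧))) (cong (_* s) (count-notBelow s t))) ⟩
    s * t + t * s ∎
    where
    open ≡-Reasoning
    ⟦xor⟧ : ∀ x y → ⟦ x xor y ⟧ ≡ ⟦ x ⟧ * ⟦ not y ⟧ + ⟦ not x ⟧ * ⟦ y ⟧
    ⟦xor⟧ true true = refl
    ⟦xor⟧ true false = refl
    ⟦xor⟧ false true = refl
    ⟦xor⟧ false false = refl

  preservesSides-inverse : (π : Permutation′ N) → PreservesSides (π ⟨$⟩ʳ_) → PreservesSides (π ⟨$⟩ˡ_)
  preservesSides-inverse π π-sides i j =
    sym (trans (π-sides (π ⟨$⟩ˡ i) (π ⟨$⟩ˡ j)) (cong₂ (adj (K s t)) (inverseʳ π) (inverseʳ π)))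

-- Placements of X in K s t

module Placements {s t m : ℕ} (X : ListedGraph (s + t) m) where

  open CompleteBipartite s t

  placements : Adj N → Subset m → ℕ
  placements g F = ∑Vec N N (λ v → aut v * ⟦ F ⊆ᵇ trace X g (lookup v) ⟧)

  exactPlacements : Adj N → Subset m → ℕ
  exactPlacements g G = ∑Vec N N (λ v → aut v * ⟦ does (trace X g (lookup v) ≟ₛ G) ⟧)

  ∑⊇-exactPlacements : ∀ g F → ∑⊇ (exactPlacements g) F ≡ placements g F
  ∑⊇-exactPlacements g F = trans (∑⊇-∑Vec N N _ F) (∑Vec-cong (λ v →
    trans (sym (*-distribˡ-∑⊇ (aut v) (λ G → ⟦ does (trace X g (lookup v) ≟ₛ G) ⟧) F))
          (cong (aut v *_) (∑⊇-point (trace X g (lookup v)) F))))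

  kelly-placements : ∀ {m′} (G : ListedGraph N m′) F →
    let open ListedGraph G in
    ∑[ k < m′ ] placements (card k) F + size F * placements adjacent F ≡ m′ * placements adjacent F
  kelly-placements {m′} G F = begin
    ∑[ k < m′ ] ∑Vec N N (λ v → aut v * removed k v) + size F * ∑Vec N N (λ v → aut v * kept v)
      ≡⟨ cong₂ _+_ (sym (∑Vec-comm (λ v k → aut v * removed k v))) (*-distribˡ-∑Vec (size F) (λ v → aut v * kept v)) ⟩
    ∑Vec N N (λ v → ∑[ k < m′ ] (aut v * removed k v)) + ∑Vec N N (λ v → size F * (aut v * kept v))
      ≡⟨ ∑Vec-distrib-+ (λ v → ∑[ k < m′ ] (aut v * removed k v)) (λ v → size F * (aut v * kept v)) ⟨
    ∑Vec N N (λ v → ∑[ k < m′ ] (aut v * removed k v) + size F * (aut v * kept v))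
      ≡⟨ ∑Vec-cong (λ v → trans (cong₂ _+_ (sym (*-distribˡ-sum (aut v) (λ k → removed k v)))
                                            (ℕ*.x∙yz≈y∙xz (size F) (aut v) (kept v)))
                               (sym (*-distribˡ-+ (aut v) _ _))) ⟩
    ∑Vec N N (λ v → aut v * (∑[ k < m′ ] removed k v + size F * kept v))
      ≡⟨ ∑Vec-cong (λ v → ⟦does⟧*-cong (isAut? (K s t) v) (λ isAut → kelly X G (autPermutation {v} isAut) F)) ⟩
    ∑Vec N N (λ v → aut v * (m′ * kept v))
      ≡⟨ ∑Vec-cong (λ v → ℕ*.x∙yz≈y∙xz (aut v) m′ (kept v)) ⟩
    ∑Vec N N (λ v → m′ * (aut v * kept v))
      ≡⟨ *-distribˡ-∑Vec m′ (λ v → aut v * kept v) ⟨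
    m′ * ∑Vec N N (λ v → aut v * kept v) ∎
    where
    open ≡-Reasoning
    open ListedGraph G
    removed : Fin m′ → Vec (Fin N) N → ℕ
    removed k v = ⟦ F ⊆ᵇ trace X (card k) (lookup v) ⟧
    kept : Vec (Fin N) N → ℕ
    kept v = ⟦ F ⊆ᵇ trace X adjacent (lookup v) ⟧

  trace-relabel : (π : Permutation′ N) {g h : Adj N} → (∀ i j → h i j ≡ g (π ⟨$⟩ʳ i) (π ⟨$⟩ʳ j)) →
                  ∀ v → trace X h (lookup v) ≡ trace X g (lookup (Vec.map (π ⟨$⟩ʳ_) v))
  trace-relabel π {g} h≡g∘π v = Vec.tabulate-cong (λ l → trans (h≡g∘π _ _)
    (sym (cong₂ g (Vec.lookup-map (ListedGraph.src X l) (π ⟨$⟩ʳ_) v)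
                  (Vec.lookup-map (ListedGraph.tgt X l) (π ⟨$⟩ʳ_) v))))

  placements-relabel : (π : Permutation′ N) → PreservesSides (π ⟨$⟩ʳ_) → {g h : Adj N} →
                       (∀ i j → h i j ≡ g (π ⟨$⟩ʳ i) (π ⟨$⟩ʳ j)) → ∀ F → placements h F ≡ placements g F
  placements-relabel π π-sides {g} {h} h≡g∘π F = begin
    ∑Vec N N (λ v → aut v * ⟦ F ⊆ᵇ trace X h (lookup v) ⟧)
      ≡⟨ ∑Vec-cong (λ v → cong₂ (λ a T → a * ⟦ F ⊆ᵇ T ⟧) (sym (aut-relabel π π-sides v))
                                                          (trace-relabel π {g} {h} h≡g∘π v)) ⟩
    ∑Vec N N (λ v → aut (Vec.map (π ⟨$⟩ʳ_) v) * ⟦ F ⊆ᵇ trace X g (lookup (Vec.map (π ⟨$⟩ʳ_) v)) ⟧)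
      ≡⟨ ∑Vec-permute π (λ v → aut v * ⟦ F ⊆ᵇ trace X g (lookup v) ⟧) ⟩
    ∑Vec N N (λ v → aut v * ⟦ F ⊆ᵇ trace X g (lookup v) ⟧) ∎
    where open ≡-Reasoning

module _ {s t m m′ : ℕ} (G : ListedGraph (s + t) m) (H : ListedGraph (s + t) m′) where

  open CompleteBipartite s t
  open ListedGraph G using () renaming (adjacent to g)
  open ListedGraph H using () renaming (adjacent to h)

  disjoint-placement-bound : g ⊆ᴬ adj (K s t) → h ⊆ᴬ adj (K s t) →
    (π : Permutation′ N) → PreservesSides (π ⟨$⟩ʳ_) →
    (∀ k → h (π ⟨$⟩ʳ ListedGraph.src G k) (π ⟨$⟩ʳ ListedGraph.tgt G k) ≡ false) →
    m * 2 + m′ * 2 ≤ s * t + t * s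
  disjoint-placement-bound G⊆K H⊆K π π-sides misses = begin
    m * 2 + m′ * 2
      ≡⟨ cong₂ _+_ (ListedGraph.edge-count G) (adjacency-count-relabel H π) ⟨
    ∑[ i < N ] ∑[ j < N ] ⟦ g i j ⟧ + ∑[ i < N ] ∑[ j < N ] ⟦ h (π ⟨$⟩ʳ i) (π ⟨$⟩ʳ j) ⟧
      ≡⟨ ∑-distrib-+ (λ i → ∑[ j < N ] ⟦ g i j ⟧) (λ i → ∑[ j < N ] ⟦ h (π ⟨$⟩ʳ i) (π ⟨$⟩ʳ j) ⟧) ⟨
    ∑[ i < N ] (∑[ j < N ] ⟦ g i j ⟧ + ∑[ j < N ] ⟦ h (π ⟨$⟩ʳ i) (π ⟨$⟩ʳ j) ⟧)
      ≡⟨ sum-cong-≗ (λ i → ∑-distrib-+ (λ j → ⟦ g i j ⟧) (λ j → ⟦ h (π ⟨$⟩ʳ i) (π ⟨$⟩ʳ j) ⟧)) ⟨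
    ∑[ i < N ] ∑[ j < N ] (⟦ g i j ⟧ + ⟦ h (π ⟨$⟩ʳ i) (π ⟨$⟩ʳ j) ⟧)
      ≤⟨ sum-mono (λ i → sum-mono (λ j → pointwise i j)) ⟩
    ∑[ i < N ] ∑[ j < N ] ⟦ adj (K s t) i j ⟧
      ≡⟨ edge-count-K ⟩
    s * t + t * s ∎
    where
    open ≤-Reasoning
    missed : ∀ {i j} → g i j ≡ true → h (π ⟨$⟩ʳ i) (π ⟨$⟩ʳ j) ≡ false
    missed = ListedGraph.on-every-edge G {P = λ i j → h (π ⟨$⟩ʳ i) (π ⟨$⟩ʳ j) ≡ false}
                                         (trans (ListedGraph.symmetric H _ _)) misses
    pointwise : ∀ i j → ⟦ g i j ⟧ + ⟦ h (π ⟨$⟩ʳ i) (π ⟨$⟩ʳ j) ⟧ ≤ ⟦ adj (K s t) i j ⟧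
    pointwise i j with g i j in gij | h (π ⟨$⟩ʳ i) (π ⟨$⟩ʳ j) in hij
    ... | true | true = contradiction (trans (sym hij) (missed gij)) λ ()
    ... | true | false = ≤-reflexive (cong ⟦_⟧ (sym (G⊆K gij)))
    ... | false | false = z≤n
    ... | false | true = ≤-reflexive (cong ⟦_⟧ (sym (trans (π-sides i j) (H⊆K hij))))

-- Reconstruction from the cards

kelly-cancel : ∀ {m c R P Q} → c < m → R + c * P ≡ m * P → R + c * Q ≡ m * Q → P ≡ Q
kelly-cancel {m} {c} {R} {P} {Q} c<m kellyP kellyQ =
  *-cancelˡ-≡ P Q (m ∸ c) {{≢-nonZero (m>n⇒m∸n≢0 c<m)}} (trans (sym (R≡ kellyP)) (R≡ kellyQ))
  where
  R≡ : ∀ {Z} → R + c * Z ≡ m * Z → R ≡ (m ∸ c) * Z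
  R≡ {Z} kelly = +-cancelʳ-≡ (c * Z) R ((m ∸ c) * Z) (begin
    R + c * Z           ≡⟨ kelly ⟩
    m * Z               ≡⟨ cong (_* Z) (m∸n+n≡m (<⇒≤ c<m)) ⟨
    (m ∸ c + c) * Z     ≡⟨ *-distribʳ-+ Z (m ∸ c) c ⟩
    (m ∸ c) * Z + c * Z ∎)
    where open ≡-Reasoning

module Reconstruction {s t m : ℕ} (X Y : ListedGraph (s + t) m)
  (X⊆K : ListedGraph.adjacent X ⊆ᴬ adj (K s t)) (Y⊆K : ListedGraph.adjacent Y ⊆ᴬ adj (K s t))
  (φ : Fin m → Permutation′ (s + t)) (φ-sides : ∀ k → CompleteBipartite.PreservesSides s t (φ k ⟨$⟩ʳ_))
  (φ-card : ∀ k i j → ListedGraph.card X k i j ≡ ListedGraph.card Y k (φ k ⟨$⟩ʳ i) (φ k ⟨$⟩ʳ j))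
  where

  open CompleteBipartite s t
  open Placements {s} {t} X
  open ListedGraph X using () renaming (adjacent to x; src to a; tgt to b)
  open ListedGraph Y using () renaming (adjacent to y)

  placements-card : ∀ k F → placements (ListedGraph.card Y k) F ≡ placements (ListedGraph.card X k) F
  placements-card k = placements-relabel (flip (φ k)) (preservesSides-inverse (φ k) (φ-sides k))
    {g = ListedGraph.card X k} {h = ListedGraph.card Y k}
    (λ i j → trans (sym (cong₂ (ListedGraph.card Y k) (inverseʳ (φ k)) (inverseʳ (φ k)))) (sym (φ-card k _ _)))

  placements-agree : ∀ F → F ≢ ⊤ → placements y F ≡ placements x F
  placements-agree F F≢⊤ = kelly-cancel (size< F F≢⊤) (kelly-placements Y F)
    (trans (cong (_+ size F * placements x F) (sum-cong-≗ (λ k → placements-card k F))) (kelly-placements X F))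

  Ay Ax : Subset m → ℕ
  Ay = exactPlacements y
  Ax = exactPlacements x

  open SupersetSumsAgree Ay Ax (λ F F≢⊤ →
    trans (∑⊇-exactPlacements y F) (trans (placements-agree F F≢⊤) (sym (∑⊇-exactPlacements x F))))

  identity-placement : 1 ≤ Ax ⊤
  identity-placement = ≤-trans (≤-reflexive (sym (cong₂ _*_ aut-identity (⟦does⟧≡1 (_ ≟ₛ ⊤) trace≡⊤))))
                               (term≤∑Vec (λ v → aut v * ⟦ does (trace X x (lookup v) ≟ₛ ⊤) ⟧) (Vec.allFin N))
    where
    trace≡⊤ : trace X x (lookup (Vec.allFin N)) ≡ ⊤
    trace≡⊤ = tabulate-replicate (λ l →
      trans (cong₂ x (Vec.lookup-allFin (a l)) (Vec.lookup-allFin (b l))) (ListedGraph.listed-adjacent X l))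

  all-placements : ∑⊇ Ax ∅ ≡ ∑Vec N N aut
  all-placements = trans (∑⊇-exactPlacements x ∅)
    (∑Vec-cong (λ v → trans (cong (λ z → aut v * ⟦ z ⟧) (∅⊆ᵇ (trace X x (lookup v)))) (*-identityʳ (aut v))))

  no-disjoint-placement : s * t < 2 * m → ∀ (G : ListedGraph N m) → ListedGraph.adjacent G ⊆ᴬ adj (K s t) →
                          exactPlacements (ListedGraph.adjacent G) ∅ ≡ 0
  no-disjoint-placement st<2m G G⊆K = ∑Vec-zero (λ v →
    trans (⟦does⟧*-cong (isAut? (K s t) v) {y = 0} (λ isAut → ⟦does⟧≡0 (_ ≟ₛ ∅) (λ trace≡∅ → <⇒≱ too-many
            (disjoint-placement-bound {s} {t} X G X⊆K G⊆K (autPermutation {v} isAut)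
               (autPermutation-preservesSides {v} isAut) (tabulate-replicate⁻ trace≡∅)))))
          (*-zeroʳ (aut v)))
    where
    too-many : s * t + t * s < m * 2 + m * 2
    too-many = subst₂ _<_ (cong (s * t +_) (*-comm s t)) (cong₂ _+_ (*-comm 2 m) (*-comm 2 m))
                          (+-mono-<-≤ st<2m (<⇒≤ st<2m))

  Isomorphism : Set
  Isomorphism = Σ (Permutation′ N) λ π → ∀ i j → x i j ≡ y (π ⟨$⟩ʳ i) (π ⟨$⟩ʳ j)

  onto-placement⇒iso : 1 ≤ Ay ⊤ → Isomorphism
  onto-placement⇒iso 0<Ay⊤ with ∑Vec-pos (λ v → aut v * ⟦ does (trace X y (lookup v) ≟ₛ ⊤) ⟧) 0<Ay⊤
  ... | v , v-pos = π , edges-onto-edges⇒iso X Y π (tabulate-replicate⁻ trace≡⊤)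
    where
    trace≡⊤ : trace X y (lookup v) ≡ ⊤
    trace≡⊤ = *⟦does⟧-pos (_ ≟ₛ ⊤) (aut v) v-pos
    π : Permutation′ N
    π = autPermutation {v} (aut-pos {v} ⟦ does (trace X y (lookup v) ≟ₛ ⊤) ⟧ (subst (0 <_) (*-comm (aut v) _) v-pos))

  reconstruct : (2 * m > s * t) ⊎ (2 ^ m > 2 * ∑Vec N N aut) → Isomorphism
  reconstruct (inj₁ st<2m) = onto-placement⇒iso (≤-trans identity-placement (≤-reflexive (sym (agree⇒agree-at-⊤ ∅
    (trans (no-disjoint-placement st<2m Y Y⊆K) (sym (no-disjoint-placement st<2m X X⊆K)))))))
  reconstruct (inj₂ 2∑aut<2^m) with Ay ⊤ in Ay⊤≡
  ... | suc _ = onto-placement⇒iso (subst (1 ≤_) (sym Ay⊤≡) (s≤s z≤n))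
  ... | zero = contradiction (≤-trans (even-bound m Ax even≤Ax) (≤-reflexive (cong (2 *_) all-placements)))
                             (<⇒≱ 2∑aut<2^m)
    where
    even≤Ax : ∀ F → ⟦ evenComplement F ⟧ ≤ Ax F
    even≤Ax F with evenComplement F in even
    ... | false = z≤n
    ... | true = ≤-trans identity-placement
                   (≤-trans (m≤n+m (Ax ⊤) (Ay F)) (≤-reflexive (sym (vanish-at-⊤⇒even-excess Ay⊤≡ F even))))

-- Walks

Walk : ∀ {N} → Adj N → Fin N → Fin N → Set
Walk g = Star (λ i j → g i j ≡ true)

odd : ℕ → Bool
odd zero = false
odd (suc n) = not (odd n)

Proper : ∀ {N} → (Fin N → Bool) → Adj N → Set
Proper col g = g ⊆ᴬ (λ i j → col i xor col j)

steps : ∀ {N} {g : Adj N} {i j} → Walk g i j → ℕ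
steps ε = 0
steps (_ ◅ w) = suc (steps w)

unique-lookup-injective : ∀ {N} {xs : List (Fin N)} → Unique xs →
                          ∀ {i j} → List.lookup xs i ≡ List.lookup xs j → i ≡ j
unique-lookup-injective {xs = x ∷ xs} (x∉xs ∷ u) {zero} {zero} _ = refl
unique-lookup-injective {xs = x ∷ xs} (x∉xs ∷ u) {zero} {suc j} eq =
  contradiction eq (All.lookup x∉xs (∈-lookup j))
unique-lookup-injective {xs = x ∷ xs} (x∉xs ∷ u) {suc i} {zero} eq =
  contradiction (sym eq) (All.lookup x∉xs (∈-lookup i))
unique-lookup-injective {xs = x ∷ xs} (x∉xs ∷ u) {suc i} {suc j} eq = cong suc (unique-lookup-injective u eq)

unique-length≤ : ∀ {N} {xs : List (Fin N)} → Unique xs → length xs ≤ N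
unique-length≤ u = injective⇒≤ (unique-lookup-injective u)

module _ {N : ℕ} {g : Adj N} where

  vertices : ∀ {i j} → Walk g i j → List (Fin N)
  vertices {i} ε = i ∷ []
  vertices {i} (_ ◅ w) = i ∷ vertices w

  traverses : ∀ {i j} → Walk g i j → Fin N → Fin N → Bool
  traverses ε c d = false
  traverses (_◅_ {i} {k} _ w) c d = samePair i k c d ∨ traverses w c d

  length-vertices : ∀ {i j} (w : Walk g i j) → length (vertices w) ≡ suc (steps w)
  length-vertices ε = refl
  length-vertices (_ ◅ w) = cong suc (length-vertices w)

  walk-parity : (col : Fin N → Bool) → Proper col g →
                ∀ {i j} (w : Walk g i j) → col i xor col j ≡ odd (steps w)
  walk-parity col proper {i} ε = xor-same (col i)
  walk-parity col proper {i} {j} (_◅_ {j = k} gik w) = begin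
    col i xor col j                             ≡⟨ cong (col i xor_) (xor-cancel (col k) (col j)) ⟩
    col i xor (col k xor (col k xor col j))     ≡⟨ xor-assoc (col i) (col k) _ ⟨
    (col i xor col k) xor (col k xor col j)     ≡⟨ cong₂ _xor_ (proper gik) (walk-parity col proper w) ⟩
    true xor odd (steps w)                      ∎
    where
    open ≡-Reasoning
    xor-cancel : ∀ a b → b ≡ a xor (a xor b)
    xor-cancel true b = sym (not-involutive b)
    xor-cancel false b = refl

  proper-colourings-agree : (c₁ c₂ : Fin N → Bool) → Proper c₁ g → Proper c₂ g →
                            ∀ {i j} → Walk g i j → c₁ i xor c₁ j ≡ c₂ i xor c₂ j
  proper-colourings-agree c₁ c₂ proper₁ proper₂ w =
    trans (walk-parity c₁ proper₁ w) (sym (walk-parity c₂ proper₂ w))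

  first-step : ∀ {i j} → Walk g i j → ¬ i ≡ j → ∃ λ k → g i k ≡ true
  first-step ε i≢i = contradiction refl i≢i
  first-step (gik ◅ _) _ = _ , gik

  traverses-swap : ∀ {i j} (w : Walk g i j) c d → traverses w c d ≡ traverses w d c
  traverses-swap ε c d = refl
  traverses-swap (_◅_ {i} {k} _ w) c d = cong₂ _∨_ (samePair-swap i k c d) (traverses-swap w c d)

  traversed⇒adjacent : (∀ c d → g c d ≡ g d c) → ∀ {i j} (w : Walk g i j) → traverses w ⊆ᴬ g
  traversed⇒adjacent g-sym (_◅_ {i} {k} gik w) {c} {d} trav with samePair i k c d in ikcd
  ... | true with samePair-true {a = i} {k} {c} {d} ikcd
  ...   | inj₁ (refl , refl) = gik
  ...   | inj₂ (refl , refl) = trans (g-sym k i) gik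
  traversed⇒adjacent g-sym (_ ◅ w) trav | false = traversed⇒adjacent g-sym w trav

  reroute : ∀ {h : Adj N} {i j} (w : Walk g i j) → traverses w ⊆ᴬ h → Σ (Walk h i j) λ w′ → steps w′ ≡ steps w
  reroute ε _ = ε , refl
  reroute {h} (_◅_ {i} {k} _ w) trav⊆h
    with reroute {h} w (λ {c} {d} trav → trav⊆h (trans (cong (samePair i k c d ∨_) trav) (∨-zeroʳ (samePair i k c d))))
  ... | w′ , same = trav⊆h (cong (_∨ traverses w i k) (samePair-refl i k)) ◅ w′ , cong suc same

  traversal-count : (∀ c → g c c ≡ false) → ∀ {i j} (w : Walk g i j) →
                    ∑[ c < N ] ∑[ d < N ] ⟦ traverses w c d ⟧ ≤ steps w * 2
  traversal-count g-irr ε = ≤-reflexive (sum-zero {n = N} (λ c → sum-zero {n = N} {f = λ d → 0} (λ _ → refl)))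
  traversal-count g-irr (_◅_ {i} {k} gik w) = begin
    ∑[ c < N ] ∑[ d < N ] ⟦ samePair i k c d ∨ traverses w c d ⟧
      ≤⟨ sum-mono (λ c → sum-mono (λ d → ⟦∨⟧≤ (samePair i k c d) (traverses w c d))) ⟩
    ∑[ c < N ] ∑[ d < N ] (⟦ samePair i k c d ⟧ + ⟦ traverses w c d ⟧)
      ≡⟨ sum-cong-≗ (λ c → ∑-distrib-+ (λ d → ⟦ samePair i k c d ⟧) (λ d → ⟦ traverses w c d ⟧)) ⟩
    ∑[ c < N ] (∑[ d < N ] ⟦ samePair i k c d ⟧ + ∑[ d < N ] ⟦ traverses w c d ⟧)
      ≡⟨ ∑-distrib-+ (λ c → ∑[ d < N ] ⟦ samePair i k c d ⟧) (λ c → ∑[ d < N ] ⟦ traverses w c d ⟧) ⟩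
    ∑[ c < N ] ∑[ d < N ] ⟦ samePair i k c d ⟧ + ∑[ c < N ] ∑[ d < N ] ⟦ traverses w c d ⟧
      ≡⟨ cong (_+ _) (trans (sum-cong-≗ (λ c → sum-cong-≗ (λ d → sym (*-identityˡ ⟦ samePair i k c d ⟧))))
                            (∑∑-samePair (λ _ _ → 1) i≢k)) ⟩
    2 + ∑[ c < N ] ∑[ d < N ] ⟦ traverses w c d ⟧
      ≤⟨ +-monoʳ-≤ 2 (traversal-count g-irr w) ⟩
    2 + steps w * 2 ∎
    where
    open ≤-Reasoning
    i≢k : ¬ i ≡ k
    i≢k refl = contradiction (trans (sym gik) (g-irr i)) λ ()

  private
    open import Data.List.Membership.DecPropositional (_≟_ {N}) using (_∈?_)

    suffix : ∀ {k j} (w : Walk g k j) {i} → i ∈ vertices w → Unique (vertices w) →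
             Σ (Walk g i j) (Unique ∘ vertices)
    suffix ε (here refl) u = ε , u
    suffix (e ◅ w) (here refl) u = e ◅ w , u
    suffix (e ◅ w) (there i∈w) (_ ∷ u) = suffix w i∈w u

  path : ∀ {i j} → Walk g i j → Σ (Walk g i j) (Unique ∘ vertices)
  path ε = ε , All.[] ∷ []
  path (_◅_ {i} e w) with path w
  ... | w′ , u with i ∈? vertices w′
  ...   | yes i∈w′ = suffix w′ i∈w′ u
  ...   | no i∉w′ = e ◅ w′ , ¬Any⇒All¬ (vertices w′) i∉w′ ∷ u

  path-steps< : ∀ {i j} (w : Walk g i j) → Unique (vertices w) → steps w < N
  path-steps< w u = subst (_≤ N) (length-vertices w) (unique-length≤ u)

odd-double : ∀ n → odd (n * 2) ≡ false
odd-double zero = refl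
odd-double (suc n) = trans (not-involutive (odd (n * 2))) (odd-double n)

balanced-sides-parity : ∀ {m L N α β} → odd L ≡ false → m ≤ suc L → suc L ≤ N → α + β ≡ N →
                        α * 2 ≤ m → β * 2 ≤ m → ⊥
balanced-sides-parity {m} {L} {N} {α} {β} L-even m≤1+L 1+L≤N α+β≡N 2α≤m 2β≤m =
  contradiction (trans (sym (odd-double α)) (trans (cong odd 2α≡m) (trans (cong odd m≡1+L) (cong not L-even)))) λ ()
  where
  open ≤-Reasoning
  2N≤2m : N * 2 ≤ m * 2
  2N≤2m = begin
    N * 2          ≡⟨ cong (_* 2) α+β≡N ⟨
    (α + β) * 2    ≡⟨ *-distribʳ-+ 2 α β ⟩
    α * 2 + β * 2  ≤⟨ +-mono-≤ 2α≤m 2β≤m ⟩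
    m + m          ≡⟨ cong (m +_) (+-identityʳ m) ⟨
    m + (m + 0)    ≡⟨ *-comm 2 m ⟩
    m * 2          ∎
  N≤m : N ≤ m
  N≤m = *-cancelʳ-≤ N m 2 2N≤2m
  m≡1+L : m ≡ suc L
  m≡1+L = ≤-antisym m≤1+L (≤-trans 1+L≤N N≤m)
  2α≡m : α * 2 ≡ m
  2α≡m = ≤-antisym 2α≤m (+-cancelʳ-≤ m m (α * 2) (begin
    m + m                ≡⟨ trans (cong (m +_) (sym (+-identityʳ m))) (*-comm 2 m) ⟩
    m * 2                ≡⟨ cong (_* 2) (≤-antisym N≤m (≤-trans m≤1+L 1+L≤N)) ⟨
    N * 2                ≡⟨ trans (cong (_* 2) (sym α+β≡N)) (*-distribʳ-+ 2 α β) ⟩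
    α * 2 + β * 2        ≤⟨ +-monoʳ-≤ (α * 2) 2β≤m ⟩
    α * 2 + m            ∎))

-- Bipartiteness of the reconstruction

module Degrees {N m : ℕ} (X : ListedGraph N m) where

  open ListedGraph X renaming (adjacent to x; src to a; tgt to b)

  degree : Fin N → ℕ
  degree c = ∑[ d < N ] ⟦ x c d ⟧

  min-degree-two : (∀ i j → Walk x i j) → (∀ k i j → Walk (card k) i j) → Fin m → ∀ c → 2 ≤ degree c
  min-degree-two connected cards-connected k₀ c = two-terms≤sum (λ d → ⟦ x c d ⟧) d₁≢d₂
    (≤-reflexive (cong ⟦_⟧ (sym c~d₁))) (≤-reflexive (cong ⟦_⟧ (sym (removeEdge⊆ x (a l) (b l) c~d₂))))
    where
    other : ∃ λ j → ¬ c ≡ j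
    other with c ≟ a k₀
    ... | yes refl = b k₀ , src≢tgt k₀
    ... | no c≢a = a k₀ , c≢a
    d₁ d₂ : Fin N
    d₁ = proj₁ (first-step (connected c (proj₁ other)) (proj₂ other))
    c~d₁ : x c d₁ ≡ true
    c~d₁ = proj₂ (first-step (connected c (proj₁ other)) (proj₂ other))
    l : Fin m
    l = proj₁ (index c~d₁)
    l≐cd₁ : samePair (a l) (b l) c d₁ ≡ true
    l≐cd₁ = proj₂ (index c~d₁)
    c≢d₁ : ¬ c ≡ d₁
    c≢d₁ c≡d₁ = contradiction (trans (sym c~d₁) (trans (cong (x c) (sym c≡d₁)) (irreflexive c))) λ ()
    d₂ = proj₁ (first-step (cards-connected l c d₁) c≢d₁)
    c~d₂ : card l c d₂ ≡ true
    c~d₂ = proj₂ (first-step (cards-connected l c d₁) c≢d₁)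
    d₁≢d₂ : ¬ d₁ ≡ d₂
    d₁≢d₂ d₁≡d₂ = contradiction
      (trans (sym l≐cd₁) (trans (cong (samePair (a l) (b l) c) d₁≡d₂) (removeEdge-removed x (a l) (b l) c~d₂))) λ ()

  side-bound : (S : Fin N → Bool) → (∀ k → ⟦ S (a k) ⟧ + ⟦ S (b k) ⟧ ≡ 1) → (∀ c → 2 ≤ degree c) →
               ∑[ c < N ] ⟦ S c ⟧ * 2 ≤ m
  side-bound S one-end min-degree = begin
    ∑[ c < N ] ⟦ S c ⟧ * 2                        ≡⟨ *-distribʳ-sum 2 (λ c → ⟦ S c ⟧) ⟩
    ∑[ c < N ] (⟦ S c ⟧ * 2)                      ≤⟨ sum-mono (λ c → *-monoʳ-≤ ⟦ S c ⟧ (min-degree c)) ⟩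
    ∑[ c < N ] (⟦ S c ⟧ * degree c)               ≡⟨ sum-cong-≗ (λ c → *-distribˡ-sum ⟦ S c ⟧ (λ d → ⟦ x c d ⟧)) ⟩
    ∑[ c < N ] ∑[ d < N ] (⟦ S c ⟧ * ⟦ x c d ⟧)   ≡⟨ handshake (λ c _ → ⟦ S c ⟧) ⟩
    ∑[ k < m ] (⟦ S (a k) ⟧ + ⟦ S (b k) ⟧)        ≡⟨ sum-cong-≗ one-end ⟩
    ∑[ k < m ] 1                                  ≡⟨ trans (sum-const m 1) (*-identityʳ m) ⟩
    m                                             ∎
    where open ≤-Reasoning

module Bipartiteness {N m : ℕ} (col : Fin N → Bool) (X Y : ListedGraph N (suc m))
  (X-proper : Proper col (ListedGraph.adjacent X))
  (X-connected : ∀ i j → Walk (ListedGraph.adjacent X) i j)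
  (X-cards-connected : ∀ k i j → Walk (ListedGraph.card X k) i j)
  (φ : Fin (suc m) → Permutation′ N)
  (φ-card : ∀ k i j → ListedGraph.card X k i j ≡ ListedGraph.card Y k (φ k ⟨$⟩ʳ i) (φ k ⟨$⟩ʳ j))
  (φ-zero : ∀ i → φ zero ⟨$⟩ʳ i ≡ i)
  where

  open ListedGraph X using () renaming (adjacent to x; src to a; tgt to b; card to cardX)
  open ListedGraph Y using () renaming (adjacent to y; src to p; tgt to q; card to cardY; symmetric to y-sym)
  open Degrees X

  cardY≡ : ∀ k i j → cardY k i j ≡ cardX k (φ k ⟨$⟩ˡ i) (φ k ⟨$⟩ˡ j)
  cardY≡ k i j = trans (sym (cong₂ (cardY k) (inverseʳ (φ k)) (inverseʳ (φ k)))) (sym (φ-card k _ _))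

  cardY-proper : ∀ k → Proper (λ c → col (φ k ⟨$⟩ˡ c)) (cardY k)
  cardY-proper k cd = X-proper (removeEdge⊆ x (a k) (b k) (trans (sym (cardY≡ k _ _)) cd))

  cardY-connected : ∀ k i j → Walk (cardY k) i j
  cardY-connected k i j = subst₂ (Walk (cardY k)) (inverseʳ (φ k)) (inverseʳ (φ k))
    (gmap (φ k ⟨$⟩ʳ_) (λ {c} {d} cd → trans (sym (φ-card k c d)) cd)
          (X-cards-connected k (φ k ⟨$⟩ˡ i) (φ k ⟨$⟩ˡ j)))

  u v : Fin N
  u = p zero
  v = q zero

  card₀ : ∀ c d → cardX zero c d ≡ cardY zero c d
  card₀ c d = trans (φ-card zero c d) (cong₂ (cardY zero) (φ-zero c) (φ-zero d))

  cardY₀-proper : Proper col (cardY zero)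
  cardY₀-proper cd = X-proper (removeEdge⊆ x (a zero) (b zero) (trans (card₀ _ _) cd))

  private
    sides-split : ∑[ c < N ] ⟦ col c ⟧ + ∑[ c < N ] ⟦ not (col c) ⟧ ≡ N
    sides-split = begin
      ∑[ c < N ] ⟦ col c ⟧ + ∑[ c < N ] ⟦ not (col c) ⟧
        ≡⟨ ∑-distrib-+ (λ c → ⟦ col c ⟧) (λ c → ⟦ not (col c) ⟧) ⟨
      ∑[ c < N ] (⟦ col c ⟧ + ⟦ not (col c) ⟧)
        ≡⟨ sum-cong-≗ (λ c → trans (+-comm ⟦ col c ⟧ _) (⟦not⟧+⟦⟧ (col c))) ⟩
      ∑[ c < N ] 1
        ≡⟨ trans (sum-const N 1) (*-identityʳ N) ⟩
      N ∎
      where open ≡-Reasoning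

    side-of-edge : ∀ (c : Fin N → Bool) → Proper c x → ∀ k → ⟦ c (a k) ⟧ + ⟦ c (b k) ⟧ ≡ 1
    side-of-edge c c-proper k with c (a k) | c (b k) | c-proper (ListedGraph.listed-adjacent X k)
    ... | true | false | _ = refl
    ... | false | true | _ = refl

    side-bounds : ∀ (c : Fin N → Bool) → Proper c x → ∑[ i < N ] ⟦ c i ⟧ * 2 ≤ suc m
    side-bounds c c-proper =
      side-bound c (side-of-edge c c-proper) (min-degree-two X-connected X-cards-connected zero)

    -- If uv had both ends of one colour, a path W from u to v in Y − uv would close an odd cycle
    -- with uv. Every other card Y − e is properly coloured, so e lies on W and m ≤ L + 1 ≤ N.
    -- Minimum degree two in X gives 2α, 2β ≤ m for the colour classes, so N ≤ m and hence
    -- m = L + 1 = 2α, which contradicts L being even.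
    module SameColour (uv-same : col u xor col v ≡ false) where

      W : Walk (cardY zero) u v
      W = proj₁ (path (cardY-connected zero u v))

      L : ℕ
      L = steps W

      L-even : odd L ≡ false
      L-even = trans (sym (walk-parity col cardY₀-proper W)) uv-same

      uv-in-other-cards : ∀ {k} → ¬ k ≡ zero → cardY k u v ≡ true
      uv-in-other-cards {k} k≢0 = removeEdge-kept y (p k) (q k) (ListedGraph.listed-adjacent Y zero) uv≢k
        where
        uv≢k : samePair (p k) (q k) u v ≡ false
        uv≢k with samePair (p k) (q k) u v in k≐uv
        ... | false = refl
        ... | true = contradiction (ListedGraph.index-unique Y {u} {v} {k} {zero} k≐uv (samePair-refl u v)) k≢0

      traversed : ∀ {c d} → y c d ≡ true → samePair u v c d ≡ false → traverses W c d ≡ true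
      traversed {c} {d} ycd cd≢uv with traverses W c d in untraversed
      ... | true = refl
      ... | false = contradiction (begin
          true                   ≡⟨ cardY-proper k (uv-in-other-cards k≢0) ⟨
          col′ u xor col′ v      ≡⟨ walk-parity col′ (cardY-proper k) W′ ⟩
          odd (steps W′)         ≡⟨ cong odd same-steps ⟩
          odd L                  ≡⟨ L-even ⟩
          false                  ∎) λ ()
        where
        open ≡-Reasoning
        k : Fin (suc m)
        k = proj₁ (ListedGraph.index Y ycd)
        k≐cd : samePair (p k) (q k) c d ≡ true
        k≐cd = proj₂ (ListedGraph.index Y ycd)
        k≢0 : ¬ k ≡ zero
        k≢0 k≡0 = contradiction (trans (sym k≐cd) (trans (cong (λ k → samePair (p k) (q k) c d) k≡0) cd≢uv)) λ ()
        col′ : Fin N → Bool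
        col′ c = col (φ k ⟨$⟩ˡ c)
        avoids-k : ∀ {c′ d′} → traverses W c′ d′ ≡ true → samePair (p k) (q k) c′ d′ ≡ false
        avoids-k {c′} {d′} trav with samePair (p k) (q k) c′ d′ in k≐c′d′
        ... | false = refl
        ... | true = contradiction (begin
          true                   ≡⟨ trav ⟨
          traverses W c′ d′      ≡⟨ samePair-respects (traverses W) (traverses-swap W) k≐c′d′ ⟩
          traverses W (p k) (q k) ≡⟨ samePair-respects (traverses W) (traverses-swap W) k≐cd ⟨
          traverses W c d        ≡⟨ untraversed ⟩
          false                  ∎) λ ()
        rerouted : Σ (Walk (cardY k) u v) λ W′ → steps W′ ≡ steps W
        rerouted = reroute {h = cardY k} W (λ trav → removeEdge-kept y (p k) (q k)
          (removeEdge⊆ y u v (traversed⇒adjacent (removeEdge-symmetric y y-sym u v) W trav)) (avoids-k trav))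
        W′ : Walk (cardY k) u v
        W′ = proj₁ rerouted
        same-steps : steps W′ ≡ L
        same-steps = proj₂ rerouted

      edges≤2+2L : suc m * 2 ≤ 2 + L * 2
      edges≤2+2L = begin
        suc m * 2
          ≡⟨ ListedGraph.edge-count Y ⟨
        ∑[ c < N ] ∑[ d < N ] ⟦ y c d ⟧
          ≤⟨ sum-mono (λ c → sum-mono (λ d → uv-or-traversed c d)) ⟩
        ∑[ c < N ] ∑[ d < N ] (⟦ samePair u v c d ⟧ + ⟦ traverses W c d ⟧)
          ≡⟨ trans (sum-cong-≗ (λ c → ∑-distrib-+ (λ d → ⟦ samePair u v c d ⟧) (λ d → ⟦ traverses W c d ⟧)))
                   (∑-distrib-+ (λ c → ∑[ d < N ] ⟦ samePair u v c d ⟧) (λ c → ∑[ d < N ] ⟦ traverses W c d ⟧)) ⟩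
        ∑[ c < N ] ∑[ d < N ] ⟦ samePair u v c d ⟧ + ∑[ c < N ] ∑[ d < N ] ⟦ traverses W c d ⟧
          ≡⟨ cong (_+ ∑[ c < N ] ∑[ d < N ] ⟦ traverses W c d ⟧)
                  (trans (sum-cong-≗ (λ c → sum-cong-≗ (λ d → sym (*-identityˡ ⟦ samePair u v c d ⟧))))
                         (∑∑-samePair (λ _ _ → 1) (ListedGraph.src≢tgt Y zero))) ⟩
        2 + ∑[ c < N ] ∑[ d < N ] ⟦ traverses W c d ⟧
          ≤⟨ +-monoʳ-≤ 2 (traversal-count cardY-irreflexive W) ⟩
        2 + L * 2 ∎
        where
        open ≤-Reasoning
        uv-or-traversed : ∀ c d → ⟦ y c d ⟧ ≤ ⟦ samePair u v c d ⟧ + ⟦ traverses W c d ⟧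
        uv-or-traversed c d with y c d in ycd | samePair u v c d in cd≐uv
        ... | false | _ = z≤n
        ... | true | true = s≤s z≤n
        ... | true | false = ≤-reflexive (cong ⟦_⟧ (sym (traversed ycd cd≐uv)))
        cardY-irreflexive : ∀ c → cardY zero c c ≡ false
        cardY-irreflexive c = cong (λ z → z ∧ not (samePair u v c c)) (ListedGraph.irreflexive Y c)

      impossible : ⊥
      impossible = balanced-sides-parity {α = ∑[ c < N ] ⟦ col c ⟧} {β = ∑[ c < N ] ⟦ not (col c) ⟧}
        L-even (*-cancelʳ-≤ (suc m) (suc L) 2 edges≤2+2L) (path-steps< W (proj₂ (path (cardY-connected zero u v))))
        sides-split (side-bounds col X-proper)
        (side-bounds (not ∘ col) (λ {i} {j} xij → trans (xor-annihilates-not (col i) (col j)) (X-proper xij)))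

  uv-crosses : col u xor col v ≡ true
  uv-crosses with col u xor col v in uv-same
  ... | true = refl
  ... | false = ⊥-elim (SameColour.impossible uv-same)

  Y-proper : Proper col y
  Y-proper {c} {d} ycd with samePair u v c d in cd≐uv
  ... | true = trans (samePair-respects (λ c d → col c xor col d) (λ c d → xor-comm (col c) (col d)) cd≐uv)
                     uv-crosses
  ... | false = cardY₀-proper (removeEdge-kept y u v ycd cd≐uv)

  φ-preservesColour : ∀ k i j → col i xor col j ≡ col (φ k ⟨$⟩ʳ i) xor col (φ k ⟨$⟩ʳ j)
  φ-preservesColour k i j = begin
    col i xor col j
      ≡⟨ cong₂ (λ c d → col c xor col d) (inverseˡ (φ k)) (inverseˡ (φ k)) ⟨
    col (φ k ⟨$⟩ˡ (φ k ⟨$⟩ʳ i)) xor col (φ k ⟨$⟩ˡ (φ k ⟨$⟩ʳ j))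
      ≡⟨ proper-colourings-agree (λ c → col (φ k ⟨$⟩ˡ c)) col (cardY-proper k)
           (λ cd → Y-proper (removeEdge⊆ y (p k) (q k) cd)) (cardY-connected k (φ k ⟨$⟩ʳ i) (φ k ⟨$⟩ʳ j)) ⟩
    col (φ k ⟨$⟩ʳ i) xor col (φ k ⟨$⟩ʳ j) ∎
    where open ≡-Reasoning

-- Relabelling along a bipartition

inLeft : ∀ {A B : Set} → A ⊎ B → Bool
inLeft = [ (λ _ → true) , (λ _ → false) ]′

length-filter-tabulate : ∀ {A : Set} {P : A → Set} (P? : Decidable P) {n} (f : Fin n → A) →
                         length (filter P? (List.tabulate f)) ≡ ∑[ i < n ] ⟦ does (P? (f i)) ⟧
length-filter-tabulate P? {zero} f = refl
length-filter-tabulate P? {suc n} f = trans (length-filter-∷ P? (f zero) (List.tabulate (f ∘ suc)))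
  (cong (⟦ does (P? (f zero)) ⟧ +_) (length-filter-tabulate P? (f ∘ suc)))

colourCount : ∀ {n} → (Fin n → Bool) → Bool → ℕ
colourCount {n} c b = ∑[ i < n ] ⟦ does (c i Bool.≟ b) ⟧

partSize≡colourCount : ∀ {n} (c : Fin n → Bool) b → partSize c b ≡ colourCount c b
partSize≡colourCount c b = length-filter-tabulate (λ i → c i Bool.≟ b) id

extendˡ : ∀ {n s} {B : Set} → Fin n ↔ (Fin s ⊎ B) → Fin (suc n) ↔ (Fin (suc s) ⊎ B)
extendˡ {n} {s} {B} ι = mk↔ₛ′ to from to-from from-to
  where
  open Inverse ι using () renaming (to to ι→; from to ι←)
  to : Fin (suc n) → Fin (suc s) ⊎ B
  to zero = inj₁ zero
  to (suc i) = Sum.map₁ suc (ι→ i)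
  from : Fin (suc s) ⊎ B → Fin (suc n)
  from (inj₁ zero) = zero
  from (inj₁ (suc j)) = suc (ι← (inj₁ j))
  from (inj₂ y) = suc (ι← (inj₂ y))
  to-from : ∀ z → to (from z) ≡ z
  to-from (inj₁ zero) = refl
  to-from (inj₁ (suc j)) = cong (Sum.map₁ suc) (Inverse.strictlyInverseˡ ι (inj₁ j))
  to-from (inj₂ y) = cong (Sum.map₁ suc) (Inverse.strictlyInverseˡ ι (inj₂ y))
  from-to : ∀ i → from (to i) ≡ i
  from-to zero = refl
  from-to (suc i) with ι→ i in eq
  ... | inj₁ j = cong suc (trans (cong ι← (sym eq)) (Inverse.strictlyInverseʳ ι i))
  ... | inj₂ y = cong suc (trans (cong ι← (sym eq)) (Inverse.strictlyInverseʳ ι i))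

extendˡ-suc : ∀ {n s} {B : Set} (ι : Fin n ↔ (Fin s ⊎ B)) i →
              inLeft (Inverse.to (extendˡ ι) (suc i)) ≡ inLeft (Inverse.to ι i)
extendˡ-suc ι i with Inverse.to ι i
... | inj₁ _ = refl
... | inj₂ _ = refl

extendʳ : ∀ {n t} {A : Set} → Fin n ↔ (A ⊎ Fin t) → Fin (suc n) ↔ (A ⊎ Fin (suc t))
extendʳ ι = swap-↔ ↔-∘ extendˡ (swap-↔ ↔-∘ ι)

extendʳ-suc : ∀ {n t} {A : Set} (ι : Fin n ↔ (A ⊎ Fin t)) i →
              inLeft (Inverse.to (extendʳ ι) (suc i)) ≡ inLeft (Inverse.to ι i)
extendʳ-suc ι i with Inverse.to ι i
... | inj₁ _ = refl
... | inj₂ _ = refl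

colourSplit : ∀ {n} (c : Fin n → Bool) →
  Σ (Fin n ↔ (Fin (colourCount c false) ⊎ Fin (colourCount c true))) λ ι → ∀ i → inLeft (Inverse.to ι i) ≡ not (c i)
colourSplit {zero} c = mk↔ₛ′ (λ ()) (λ { (inj₁ ()) ; (inj₂ ()) }) (λ { (inj₁ ()) ; (inj₂ ()) }) (λ ()) , λ ()
colourSplit {suc n} c =
  extend (c zero) ι , λ { zero → extend-zero (c zero) ; (suc i) → trans (extend-suc (c zero) i) (ι-colour i) }
  where
  s t : ℕ
  s = colourCount (c ∘ suc) false
  t = colourCount (c ∘ suc) true
  ι : Fin n ↔ (Fin s ⊎ Fin t)
  ι = proj₁ (colourSplit (c ∘ suc))
  ι-colour : ∀ i → inLeft (Inverse.to ι i) ≡ not (c (suc i))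
  ι-colour = proj₂ (colourSplit (c ∘ suc))
  extend : ∀ b → Fin n ↔ (Fin s ⊎ Fin t) →
           Fin (suc n) ↔ (Fin (⟦ does (b Bool.≟ false) ⟧ + s) ⊎ Fin (⟦ does (b Bool.≟ true) ⟧ + t))
  extend false = extendˡ
  extend true = extendʳ
  extend-zero : ∀ b → inLeft (Inverse.to (extend b ι) zero) ≡ not b
  extend-zero false = refl
  extend-zero true = refl
  extend-suc : ∀ b i → inLeft (Inverse.to (extend b ι) (suc i)) ≡ inLeft (Inverse.to ι i)
  extend-suc false = extendˡ-suc ι
  extend-suc true = extendʳ-suc ι

inA-join : ∀ s t (z : Fin s ⊎ Fin t) → CompleteBipartite.inA s t (join s t z) ≡ inLeft z
inA-join s t (inj₁ i) with toℕ (i ↑ˡ t) <? s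
... | yes _ = refl
... | no ≮s = contradiction (subst (_< s) (sym (toℕ-↑ˡ i t)) (toℕ<n i)) ≮s
inA-join s t (inj₂ j) with toℕ (s ↑ʳ j) <? s
... | no _ = refl
... | yes <s = contradiction (subst (_< s) (toℕ-↑ʳ s j) <s) (m+n≮m s (toℕ j))

sidesRelabelling : ∀ {n} (c : Fin n → Bool) → let s = partSize c false; t = partSize c true in
                   Σ (Permutation n (s + t)) λ ρ → ∀ i → CompleteBipartite.inA s t (ρ ⟨$⟩ʳ i) ≡ not (c i)
sidesRelabelling {n} c rewrite partSize≡colourCount c false | partSize≡colourCount c true =
  ↔-sym +↔⊎ ↔-∘ ι , λ i → trans (inA-join _ _ (Inverse.to ι i)) (ι-colour i)
  where
  ι : Fin n ↔ (Fin (colourCount c false) ⊎ Fin (colourCount c true))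
  ι = proj₁ (colourSplit c)
  ι-colour : ∀ i → inLeft (Inverse.to ι i) ≡ not (c i)
  ι-colour = proj₂ (colourSplit c)

-- Listing the edges of a graph

edge-≡ : ∀ {G : Graph} {E E′ : Edge G} → proj₁ E ≡ proj₁ E′ → E ≡ E′
edge-≡ {E = (ij , i<j , adj≡)} {E′ = (.ij , i<j′ , adj≡′)} refl =
  cong₂ (λ p q → ij , p , q) (<ᶠ-irrelevant i<j i<j′) (Decidable⇒UIP.≡-irrelevant Bool._≟_ adj≡ adj≡′)

module FromGraph (G : Graph) {m : ℕ} (e : Fin m ⤖ Edge G) where

  private
    edge : Fin m → Edge G
    edge = Bijection.to e

    index : Edge G → Fin m
    index E = proj₁ (Bijection.surjective e E)

    edge-index : ∀ E → edge (index E) ≡ E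
    edge-index E = proj₂ (Bijection.surjective e E) refl

    src tgt : Fin m → Fin (n G)
    src k = proj₁ (proj₁ (edge k))
    tgt k = proj₂ (proj₁ (edge k))

    ordered-listing : ∀ {i j} (i<j : i <ᶠ j) (i~j : adj G i j ≡ true) k →
                      ⟦ samePair (src k) (tgt k) i j ⟧ ≡ δ k (index ((i , j) , i<j , i~j))
    ordered-listing {i} {j} i<j i~j k with samePair (src k) (tgt k) i j in k≐ij | k ≟ index ((i , j) , i<j , i~j)
    ... | false | no _ = refl
    ... | false | yes refl = contradiction (trans (sym k≐ij) (subst₂ (λ a b → samePair (src k) (tgt k) a b ≡ true)
      (cong (proj₁ ∘ proj₁) (edge-index _)) (cong (proj₂ ∘ proj₁) (edge-index _)) (samePair-refl (src k) (tgt k)))) λ ()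
    ... | true | yes _ = refl
    ... | true | no k≢index with samePair-true {a = src k} {tgt k} {i} {j} k≐ij
    ...   | inj₁ (refl , refl) =
      contradiction (Bijection.injective e (trans (edge-≡ {G} refl) (sym (edge-index _)))) k≢index
    ...   | inj₂ (refl , refl) = contradiction (proj₁ (proj₂ (edge k))) (<ᶠ-asym i<j)

  listing : ListedGraph (n G) m
  listing = record
    { adjacent = adj G ; symmetric = adj-sym G ; irreflexive = adj-irr G
    ; src = src ; tgt = tgt ; enumerates = enumerates }
    where
    enumerates : Enumerates src tgt (adj G)
    enumerates i j with adj G i j in i~j
    ... | false = sym (sum-zero unlisted)
      where
      unlisted : ∀ k → ⟦ samePair (src k) (tgt k) i j ⟧ ≡ 0
      unlisted k with samePair (src k) (tgt k) i j in k≐ij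
      ... | false = refl
      ... | true = contradiction
        (trans (sym i~j) (trans (samePair-respects (adj G) (adj-sym G) k≐ij) (proj₂ (proj₂ (edge k))))) λ ()
    ... | true with <ᶠ-cmp i j
    ...   | tri< i<j _ _ = sym (trans (sum-cong-≗ (ordered-listing i<j i~j)) (sum-δ≡1 (index ((i , j) , i<j , i~j))))
    ...   | tri≈ _ refl _ = contradiction (trans (sym i~j) (adj-irr G i)) λ ()
    ...   | tri> _ _ j<i = sym (trans
      (sum-cong-≗ (λ k → trans (cong ⟦_⟧ (samePair-swap (src k) (tgt k) i j))
                               (ordered-listing j<i (trans (adj-sym G j i) i~j) k)))
      (sum-δ≡1 (index ((j , i) , j<i , trans (adj-sym G j i) i~j))))

reach⇒walk : ∀ (G : Graph) {N} {h : Adj N} (f : Fin (n G) → Fin N) →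
             (∀ {i j} → adj G i j ≡ true → h (f i) (f j) ≡ true) → ∀ {i j} → Reach G i j → Walk h (f i) (f j)
reach⇒walk G f preserves here = ε
reach⇒walk G f preserves (step i~k r) = preserves i~k ◅ reach⇒walk G f preserves r

connected⇒walks : ∀ (G : Graph) {N} {h : Adj N} (ρ : Permutation (n G) N) →
                  (∀ i j → adj G i j ≡ h (ρ ⟨$⟩ʳ i) (ρ ⟨$⟩ʳ j)) → Connected G → ∀ i j → Walk h i j
connected⇒walks G {h = h} ρ adj≡ connected i j = subst₂ (Walk h) (inverseʳ ρ) (inverseʳ ρ)
  (reach⇒walk G (ρ ⟨$⟩ʳ_) (λ {i} {j} i~j → trans (sym (adj≡ i j)) i~j) (connected (ρ ⟨$⟩ˡ i) (ρ ⟨$⟩ˡ j)))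

distinct⇒xor : ∀ {a b} → ¬ a ≡ b → a xor b ≡ true
distinct⇒xor {true} {true} a≢b = ⊥-elim (a≢b refl)
distinct⇒xor {true} {false} _ = refl
distinct⇒xor {false} {true} _ = refl
distinct⇒xor {false} {false} a≢b = ⊥-elim (a≢b refl)

module Relabelled (X : Graph) {m : ℕ} (eX : Fin (suc m) ⤖ Edge X) (X-connected : Connected X)
  (X-cards-connected : ∀ e → Connected (X ─ e)) (c : Fin (n X) → Bool) (bipartition : IsBipartition X c)
  (Y : Graph) (f : Edge X ⤖ Edge Y) (cards : ∀ e → (X ─ e) ≅ (Y ─ Bijection.to f e)) where

  s t N : ℕ
  s = partSize c false
  t = partSize c true
  N = s + t

  open CompleteBipartite s t using (inA)

  ρ : Permutation (n X) N
  ρ = proj₁ (sidesRelabelling c)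

  φ : Fin (suc m) → Fin (n X) ↔ Fin (n Y)
  φ k = ⤖⇒↔ (proj₁ (cards (Bijection.to eX k)))

  -- Y is relabelled through the isomorphism of the first cards, so that the first card of Y′
  -- is literally that of X′ (ψ-zero).
  ρY : Permutation (n Y) N
  ρY = ρ ↔-∘ ↔-sym (φ zero)

  X′ Y′ : ListedGraph N (suc m)
  X′ = relabel (FromGraph.listing X eX) ρ
  Y′ = relabel (FromGraph.listing Y (f ⤖-∘ eX)) ρY

  ψ : Fin (suc m) → Permutation′ N
  ψ k = ρY ↔-∘ (φ k ↔-∘ ↔-sym ρ)

  ψ-card : ∀ k i j → ListedGraph.card X′ k i j ≡ ListedGraph.card Y′ k (ψ k ⟨$⟩ʳ i) (ψ k ⟨$⟩ʳ j)
  ψ-card k i j = begin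
    ListedGraph.card X′ k i j
      ≡⟨ card-relabel (FromGraph.listing X eX) ρ k i j ⟩
    adj (X ─ Bijection.to eX k) (ρ ⟨$⟩ˡ i) (ρ ⟨$⟩ˡ j)
      ≡⟨ proj₂ (cards (Bijection.to eX k)) _ _ ⟩
    adj (Y ─ Bijection.to f (Bijection.to eX k)) (Inverse.to (φ k) (ρ ⟨$⟩ˡ i)) (Inverse.to (φ k) (ρ ⟨$⟩ˡ j))
      ≡⟨ cong₂ (adj (Y ─ Bijection.to f (Bijection.to eX k))) (inverseˡ ρY) (inverseˡ ρY) ⟨
    adj (Y ─ Bijection.to f (Bijection.to eX k)) (ρY ⟨$⟩ˡ (ψ k ⟨$⟩ʳ i)) (ρY ⟨$⟩ˡ (ψ k ⟨$⟩ʳ j))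
      ≡⟨ card-relabel (FromGraph.listing Y (f ⤖-∘ eX)) ρY k _ _ ⟨
    ListedGraph.card Y′ k (ψ k ⟨$⟩ʳ i) (ψ k ⟨$⟩ʳ j) ∎
    where open ≡-Reasoning

  ψ-zero : ∀ i → ψ zero ⟨$⟩ʳ i ≡ i
  ψ-zero i = trans (cong (ρ ⟨$⟩ʳ_) (Inverse.strictlyInverseʳ (φ zero) (ρ ⟨$⟩ˡ i))) (inverseʳ ρ)

  X′-proper : Proper inA (ListedGraph.adjacent X′)
  X′-proper {i} {j} i~j = begin
    inA i xor inA j
      ≡⟨ cong₂ (λ a b → inA a xor inA b) (inverseʳ ρ) (inverseʳ ρ) ⟨
    inA (ρ ⟨$⟩ʳ (ρ ⟨$⟩ˡ i)) xor inA (ρ ⟨$⟩ʳ (ρ ⟨$⟩ˡ j))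
      ≡⟨ cong₂ _xor_ (proj₂ (sidesRelabelling c) _) (proj₂ (sidesRelabelling c) _) ⟩
    not (c (ρ ⟨$⟩ˡ i)) xor not (c (ρ ⟨$⟩ˡ j))
      ≡⟨ xor-annihilates-not (c (ρ ⟨$⟩ˡ i)) (c (ρ ⟨$⟩ˡ j)) ⟩
    c (ρ ⟨$⟩ˡ i) xor c (ρ ⟨$⟩ˡ j)
      ≡⟨ distinct⇒xor (bipartition _ _ i~j) ⟩
    true ∎
    where open ≡-Reasoning

  X′-connected : ∀ i j → Walk (ListedGraph.adjacent X′) i j
  X′-connected = connected⇒walks X ρ (λ i j → cong₂ (adj X) (sym (inverseˡ ρ)) (sym (inverseˡ ρ))) X-connected

  X′-cards-connected : ∀ k i j → Walk (ListedGraph.card X′ k) i j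
  X′-cards-connected k = connected⇒walks (X ─ Bijection.to eX k) ρ
    (λ i j → trans (cong₂ (adj (X ─ Bijection.to eX k)) (sym (inverseˡ ρ)) (sym (inverseˡ ρ)))
                   (sym (card-relabel (FromGraph.listing X eX) ρ k _ _)))
    (X-cards-connected (Bijection.to eX k))

  open Bipartiteness inA X′ Y′ X′-proper X′-connected X′-cards-connected ψ ψ-card ψ-zero
    using (Y-proper; φ-preservesColour)
  open Reconstruction {s} {t} X′ Y′ X′-proper Y-proper ψ φ-preservesColour ψ-card using (Isomorphism; reconstruct)

  isomorphic : (2 * suc m > s * t) ⊎ (2 ^ suc m > 2 * autOrder (K s t)) → X ≅ Y
  isomorphic bound = ↔⇒⤖ Φ , λ i j → begin
    adj X i j                                  ≡⟨ cong₂ (adj X) (inverseˡ ρ) (inverseˡ ρ) ⟨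
    ListedGraph.adjacent X′ (ρ ⟨$⟩ʳ i) (ρ ⟨$⟩ʳ j)  ≡⟨ proj₂ π _ _ ⟩
    ListedGraph.adjacent Y′ (proj₁ π ⟨$⟩ʳ (ρ ⟨$⟩ʳ i)) (proj₁ π ⟨$⟩ʳ (ρ ⟨$⟩ʳ j)) ∎
    where
    open ≡-Reasoning
    π : Isomorphism
    π = reconstruct (Sum.map₂ (subst (λ a → 2 ^ suc m > 2 * a) (CompleteBipartite.autOrder≡∑aut s t)) bound)
    Φ : Fin (n X) ↔ Fin (n Y)
    Φ = ↔-sym ρY ↔-∘ (proj₁ π ↔-∘ ρ)

proposition2p2 : (X : Graph) (m : ℕ) → (Fin m ⤖ Edge X) → TwoEdgeConnected X →
    (c : Fin (n X) → Bool) → IsBipartition X c →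
    (2 * m > partSize c false * partSize c true)
    ⊎ (2 ^ m > 2 * autOrder (K (partSize c false) (partSize c true))) →
    EdgeReconstructible X
proposition2p2 X zero _ _ c _ (inj₁ ())
proposition2p2 X zero _ _ c _ (inj₂ 1>2∣aut∣) = ⊥-elim (<⇒≱ 1>2∣aut∣ (≤-trans 1≤∣aut∣ (m≤m+n _ _)))
  where
  open CompleteBipartite (partSize c false) (partSize c true)
  1≤∣aut∣ : 1 ≤ autOrder (K (partSize c false) (partSize c true))
  1≤∣aut∣ = subst (1 ≤_) (sym autOrder≡∑aut) 1≤∑aut
proposition2p2 X (suc m) eX (connected , cards-connected) c bipartition bound Y f cards =
  Relabelled.isomorphic X eX connected cards-connected c bipartition Y f cards bound
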